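{- Let $m\ge1$ be an integer. Let $L^{(1)}$ be an $\mathbb{F}_2$-subline of $\mathrm{PG}(1,2^2)$, i.e. an $\mathbb{F}_2$-linear set $L_{U^{(1)}}$ of rank $2$ in $\mathrm{PG}(1,4)$ all of whose points have weight $1$. For $j=1,\dots,m-1$, given the $\mathbb{F}_2$-linear set $L^{(j)}=L_{U^{(j)}}$ of rank $2^j$ in $\mathrm{PG}(1,2^{2^j})$, choose an invertible $\mathbb{F}_{2^{2^j}}$-linear map $\varphi_j$ of $\mathbb{F}_{2^{2^j}}^2$ and an $\mathbb{F}_2$-linearised polynomial $f_j$ over $\mathbb{F}_{2^{2^j}}$ with $\varphi_j(U^{(j)})=\{(x,f_j(x)):x\in\mathbb{F}_{2^{2^j}}\}$ and $\langle(1,0)\rangle\notin L_{f_j}$, choose $\xi_j\in\mathbb{F}_{2^{2^{j+1}}}\setminus\mathbb{F}_{2^{2^j}}$, and set $U^{(j+1)}=\mathbb{F}_{2^{2^j}}\times S_{f_j,\xi_j}$ and $L^{(j+1)}=L_{U^{(j+1)}}\subseteq\mathrm{PG}(1,2^{2^{j+1}})$. Then $L^{(m)}$ has exactly $3\prod_{i=1}^{m-1}(2^{2^i}-1)$ points of weight $1$ and exactly $2\prod_{i=k+1}^{m-1}(2^{2^i}-1)$ points of weight $2^k$ for each $1\le k\le m-1$ (an empty product being $1$), and $|L^{(m)}|=\prod_{i=0}^{m-1}(2^{2^i}-1)+2\sum_{k=0}^{m-1}\prod_{i=k+1}^{m-1}(2^{2^i}-1)$.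
   Context: For an $\mathbb{F}_q$-subspace $U$ of $\mathbb{F}_{q^N}^2$, $L_U=\{\langle u\rangle_{\mathbb{F}_{q^N}}: u\in U\setminus\{0\}\}\subseteq\mathrm{PG}(1,q^N)$, its rank is $\dim_{\mathbb{F}_q}U$, and the weight of a point $\langle v\rangle$ is $\dim_{\mathbb{F}_q}(U\cap\langle v\rangle_{\mathbb{F}_{q^N}})$. For an $\mathbb{F}_q$-linearised polynomial $f$ over $\mathbb{F}_{q^t}$, $L_f=\{\langle(x,f(x))\rangle_{\mathbb{F}_{q^t}}:x\in\mathbb{F}_{q^t}^*\}$, and for $\xi\in\mathbb{F}_{q^{2t}}\setminus\mathbb{F}_{q^t}$, $S_{f,\xi}=\{u+\xi f(u):u\in\mathbb{F}_{q^t}\}$. The paper denotes $L^{(m)}$ by $\Psi^{m-1}(L_f)$, where $\Psi$ sends $L_f\subseteq\mathrm{PG}(1,q^t)$ to $L_{\mathbb{F}_{q^t}\times S_{f,\xi}}\subseteq\mathrm{PG}(1,q^{2t})$. -}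

module Defs where

open import Data.Nat using (ℕ; zero; suc; _+_; _*_; _∸_; _^_; _≤_; _<_; _≡ᵇ_; _≤ᵇ_)
open import Data.Bool using (Bool; true; false; _xor_; _∧_; not)
import Data.Bool as Bool
open import Data.List using (List; []; _∷_; map; concatMap; length; filterᵇ; drop; upTo)
open import Data.Bool.ListAction using (any)
open import Data.Nat.ListAction using (product; sum)
open import Data.Maybe using (Maybe; nothing; just)
open import Data.Product using (_×_; _,_; Σ; ∃)
open import Relation.Binary.PropositionalEquality using (_≡_; _≢_; refl)
open import Relation.Nullary using (Dec; yes; no)

-- The finite field F_{2^{2^j}} realised concretely as Wiedemann's tower:
--   F 0 = F_2,  F (suc j) = F j [X_{j+1}] / (X_{j+1}^2 + x_j X_{j+1} + 1),
-- with x_0 = 1 and x_{j+1} = X_{j+1}.  An element  pair a b  of F (suc j)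
-- stands for a + b X_{j+1}.

data F : ℕ → Set where
  bit  : Bool → F 0
  pair : ∀ {j} → F j → F j → F (suc j)

zeroF : ∀ j → F j
zeroF zero    = bit false
zeroF (suc j) = pair (zeroF j) (zeroF j)

oneF : ∀ j → F j
oneF zero    = bit true
oneF (suc j) = pair (oneF j) (zeroF j)

gen : ∀ j → F j
gen zero    = bit true
gen (suc j) = pair (zeroF j) (oneF j)

infixl 6 _+F_
infixl 7 _*F_

_+F_ : ∀ {j} → F j → F j → F j
bit a    +F bit b    = bit (a xor b)
pair a b +F pair c d = pair (a +F c) (b +F d)

_*F_ : ∀ {j} → F j → F j → F j
bit a        *F bit b    = bit (a ∧ b)
pair {j} a b *F pair c d =
  pair (a *F c +F b *F d) (a *F d +F b *F c +F (b *F d) *F gen j)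

ι : ∀ {j} → F j → F (suc j)
ι {j} a = pair a (zeroF j)

isZeroᵇ : ∀ {j} → F j → Bool
isZeroᵇ (bit b)    = not b
isZeroᵇ (pair a b) = isZeroᵇ a ∧ isZeroᵇ b

elems : ∀ j → List (F j)
elems zero    = bit false ∷ bit true ∷ []
elems (suc j) = concatMap (λ a → map (pair a) (elems j)) (elems j)

V2 : ℕ → Set
V2 j = F j × F j

_+V_ : ∀ {j} → V2 j → V2 j → V2 j
(a , b) +V (c , d) = (a +F c , b +F d)

scale : ∀ {j} → F j → V2 j → V2 j
scale l (a , b) = (l *F a , l *F b)

allV2 : ∀ j → List (V2 j)
allV2 j = concatMap (λ a → map (a ,_) (elems j)) (elems j)

Sub : ℕ → Set
Sub j = V2 j → Bool

cardSub : ∀ {j} → Sub j → ℕ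
cardSub {j} U = length (filterᵇ U (allV2 j))

Point : ℕ → Set
Point j = Maybe (F j)

rep : ∀ {j} → Point j → V2 j
rep {j} nothing  = (zeroF j , oneF j)
rep {j} (just a) = (oneF j , a)

points : ∀ j → List (Point j)
points j = nothing ∷ map just (elems j)

-- |U ∩ ⟨rep P⟩_{F_{2^{2^j}}}|  ( = 2^(weight of P) for an F_2-subspace U )
wcard : ∀ {j} → Sub j → Point j → ℕ
wcard {j} U P = length (filterᵇ (λ l → U (scale l (rep P))) (elems j))

inLᵇ : ∀ {j} → Sub j → Point j → Bool
inLᵇ {j} U P = any (λ l → not (isZeroᵇ l) ∧ U (scale l (rep P))) (elems j)

sizeL : ∀ {j} → Sub j → ℕ
sizeL {j} U = length (filterᵇ (inLᵇ U) (points j))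

nWeight : ∀ {j} → Sub j → ℕ → ℕ
nWeight {j} U w = length (filterᵇ (λ P → wcard U P ≡ᵇ 2 ^ w) (points j))

IsF2Subspace : ∀ {j} → Sub j → Set
IsF2Subspace {j} U =
  (U (zeroF j , zeroF j) ≡ true) ×
  (∀ u v → U u ≡ true → U v ≡ true → U (u +V v) ≡ true)

-- F_2-subline: rank 2 and all points of L_U have weight 1
IsSubline : ∀ {j} → Sub j → Set
IsSubline U = IsF2Subspace U × (cardSub U ≡ 4) × (∀ P → wcard U P ≤ 2)

record Mat (j : ℕ) : Set where
  constructor mat
  field
    m11 m12 m21 m22 : F j

applyM : ∀ {j} → Mat j → V2 j → V2 j
applyM (mat a b c d) (x , y) = (a *F x +F b *F y , c *F x +F d *F y)

-- determinant (characteristic 2, so - = +)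
detM : ∀ {j} → Mat j → F j
detM (mat a b c d) = a *F d +F b *F c

-- F_2-linearised polynomial  Σ_i a_i x^{2^i}  given by coefficients [a_0, a_1, …]
LinPoly : ℕ → Set
LinPoly j = List (F j)

evalLin : ∀ {j} → LinPoly j → F j → F j
evalLin {j} []       x = zeroF j
evalLin     (a ∷ as) x = a *F x +F evalLin as (x *F x)

OneZeroInLf : ∀ {j} → LinPoly j → Set
OneZeroInLf {j} f =
  Σ (F j) λ x → (x ≢ zeroF j) ×
  Σ (F j) λ l → (l ≢ zeroF j) × ((x , evalLin f x) ≡ scale l (oneF j , zeroF j))

ImageIsGraph : ∀ {j} → Mat j → Sub j → LinPoly j → Set
ImageIsGraph {j} φ U f = ∀ (w : V2 j) →
  ((Σ (V2 j) λ u → (U u ≡ true) × (applyM φ u ≡ w)) → Σ (F j) λ x → w ≡ (x , evalLin f x)) ×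
  ((Σ (F j) λ x → w ≡ (x , evalLin f x)) → Σ (V2 j) λ u → (U u ≡ true) × (applyM φ u ≡ w))

IsPsiStep : ∀ {j} → LinPoly j → F (suc j) → Sub j → Sub (suc j) → Set
IsPsiStep {j} f ξ U U' = ∀ (w : V2 (suc j)) →
  ((U' w ≡ true) → Σ (F j) λ a → Σ (F j) λ u → w ≡ (ι a , ι u +F ξ *F ι (evalLin f u))) ×
  ((Σ (F j) λ a → Σ (F j) λ u → w ≡ (ι a , ι u +F ξ *F ι (evalLin f u))) → U' w ≡ true)

prodFrom : ℕ → ℕ → ℕ
prodFrom k m = product (map (λ i → 2 ^ (2 ^ i) ∸ 1) (drop k (upTo m)))

sumProds : ℕ → ℕ
sumProds m = sum (map (λ k → prodFrom (suc k) m) (upTo m))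

-- Write q = 2^(2^j) and U′ = F_q × S_{f,ξ} ⊆ F_{q²}². As {1, ξ} is an F_q-basis of F_{q²}, the map
-- ψ w = x + ξ y, where (x, y) = φ w, is an F_q-linear bijection F_q² → F_{q²} carrying U onto S_{f,ξ}.
-- Hence U′ meets the point ⟨(1, ψ w)⟩ in {(a, a ψ w) : a ∈ F_q, a w ∈ U}, so that
-- |U′ ∩ ⟨(1, ψ w)⟩| = |U ∩ F_q w|, while |U′ ∩ ⟨(0, 1)⟩| = q. Summing over w ∈ F_q², and using that
-- 0 ∈ U and that every point of PG(1, q) has q − 1 nonzero representatives, the number N(p) of
-- points whose intersection with U has a size satisfying p obeys N′(p) = 2 [p q] + (q − 1) N(p).
-- A subline of PG(1, 4) starts the recursion with N(p) = 3 [p 2] + 2 [p 1]; solving it for the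
-- predicates (= 2), (= 2^(2^k)) and (≠ 1) gives the three formulas.

module Submission where

open import Defs
open import Data.Nat using (ℕ; zero; suc; _+_; _*_; _^_; _∸_; _≤_; _<_; _≡ᵇ_; z≤n; s≤s; s≤s⁻¹)
open import Data.Product using (_×_; _,_; proj₁; proj₂; ∃-syntax; ∃₂)
open import Relation.Binary.PropositionalEquality
  using (_≡_; _≢_; refl; sym; trans; cong; cong₂; subst; isEquivalence; module ≡-Reasoning)
open import Relation.Nullary using (¬_; yes; no)

open import Algebra.Bundles using (CommutativeRing)
import Algebra.Consequences.Propositional as Consequences
open import Algebra.Core using (Op₂)
open import Algebra.Definitions using (Associative; Commutative; LeftIdentity; _DistributesOverʳ_)
open import Algebra.Solver.Ring.AlmostCommutativeRing using (fromCommutativeRing; _-Raw-AlmostCommutative⟶_)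
open import Algebra.Structures using (IsCommutativeRing)
open import Data.Bool using (Bool; true; false; _xor_; _∧_; not; if_then_else_)
open import Data.Bool.ListAction using (any)
open import Data.Bool.Properties using (T?; T-≡; xor-∧-commutativeRing)
import Data.Bool.Properties as Bool
open import Data.Empty using (⊥-elim)
open import Data.List
  using (List; []; _∷_; _++_; _∷ʳ_; length; map; filterᵇ; concatMap; cartesianProductWith; cartesianProduct; drop; upTo)
open import Data.List.Membership.Propositional using (_∈_)
open import Data.List.Membership.Propositional.Properties
  using (∈-filter⁺; ∈-filter⁻; ∈-map∘filter⁺; ∈-map∘filter⁻; ∈-map⁺; ∈-map⁻; ∈-cartesianProductWith⁺; ∈-upTo⁻)
open import Data.List.Membership.Propositional.Properties.WithK using (unique∧set⇒bag)
open import Data.List.Properties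
  using (length-map; length-++; filter-++; map-cong; map-cong-local; map-++; upTo-∷ʳ; length-upTo; drop-all)
open import Data.List.Relation.Binary.BagAndSetEquality using (∼bag⇒↭)
open import Data.List.Relation.Binary.Permutation.Propositional.Properties using (↭-length)
open import Data.List.Relation.Unary.All using ([]; _∷_)
import Data.List.Relation.Unary.All as All
import Data.List.Relation.Unary.All.Properties as Allₚ
open import Data.List.Relation.Unary.Any using (here; there)
open import Data.List.Relation.Unary.Unique.Propositional using (Unique; []; _∷_)
open import Data.List.Relation.Unary.Unique.Propositional.Properties using (filter⁺; cartesianProductWith⁺)
open import Data.Maybe using (Maybe; just; nothing)
import Data.Nat as ℕ
open import Data.Nat.ListAction using (sum; product)
open import Data.Nat.ListAction.Properties using (sum-++; product-++)
import Data.Nat.Properties as ℕₚ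
open import Algebra.Properties.CommutativeSemigroup ℕₚ.+-commutativeSemigroup using (x∙yz≈y∙xz)
open import Data.Nat.Solver using (module +-*-Solver)
open import Data.Sum using (inj₁; inj₂)
open import Function using (id; _∘_; case_of_)
open import Function.Bundles using (Equivalence; mk⇔)
open import Relation.Nullary.Decidable using (proof)
open import Relation.Nullary.Reflects using (Reflects; ofʸ; ofⁿ; det; _×-reflects_)

open ≡-Reasoning

-- Commutative rings of characteristic 2

module _ {A : Set} {_+_ _*_ : Op₂ A} {0# 1# : A} where

  isCommutativeRing-char2 :
    Associative _≡_ _+_ → Commutative _≡_ _+_ → LeftIdentity _≡_ 0# _+_ → (∀ x → x + x ≡ 0#) →
    Associative _≡_ _*_ → Commutative _≡_ _*_ → LeftIdentity _≡_ 1# _*_ → _DistributesOverʳ_ _≡_ _*_ _+_ →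
    IsCommutativeRing _≡_ _+_ _*_ id 0# 1#
  isCommutativeRing-char2 +-assoc +-comm +-identityˡ +-self *-assoc *-comm *-identityˡ distribʳ = record
    { isRing = record
      { +-isAbelianGroup = record
        { isGroup = record
          { isMonoid = record
            { isSemigroup = record
              { isMagma = record { isEquivalence = isEquivalence ; ∙-cong = cong₂ _+_ }
              ; assoc = +-assoc }
            ; identity = comm∧idˡ⇒id +-comm +-identityˡ }
          ; inverse = +-self , +-self
          ; ⁻¹-cong = cong id }
        ; comm = +-comm }
      ; *-cong = cong₂ _*_
      ; *-assoc = *-assoc
      ; *-identity = comm∧idˡ⇒id *-comm *-identityˡ
      ; distrib = comm∧distrʳ⇒distrˡ *-comm distribʳ , distribʳ }
    ; *-comm = *-comm }
    where open Consequences

-- Coefficients in F₂ let the normaliser cancel x + x, so identities that hold only in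
-- characteristic 2 are solved as well.
module Char2RingSolver {A : Set} {_+_ _*_ : Op₂ A} {0# 1# : A}
  (isCommutativeRing : IsCommutativeRing _≡_ _+_ _*_ id 0# 1#) where

  open IsCommutativeRing isCommutativeRing using (+-identityˡ; +-identityʳ; -‿inverseʳ; zeroˡ; *-identityˡ)

  private
    F₂ = CommutativeRing.rawRing xor-∧-commutativeRing
    R = fromCommutativeRing (record { isCommutativeRing = isCommutativeRing })

    embed : Bool → A
    embed b = if b then 1# else 0#

    F₂-embedding : F₂ -Raw-AlmostCommutative⟶ R
    F₂-embedding = record
      { ⟦_⟧ = embed
      ; +-homo = λ { false y → sym (+-identityˡ (embed y))
                   ; true false → sym (+-identityʳ 1#)
                   ; true true → sym (-‿inverseʳ 1#) }
      ; *-homo = λ { false y → sym (zeroˡ (embed y)) ; true y → sym (*-identityˡ (embed y)) }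
      ; -‿homo = λ _ → refl
      ; 0-homo = refl
      ; 1-homo = refl }

    _≟F₂_ : ∀ x y → Maybe (embed x ≡ embed y)
    x ≟F₂ y with x Bool.≟ y
    ... | yes refl = just refl
    ... | no _ = nothing

  open import Algebra.Solver.Ring F₂ R F₂-embedding _≟F₂_ public using (solve; con; _:+_; _:*_; _:=_)

Reflects-map : ∀ {A B : Set} {b} → (A → B) → (B → A) → Reflects A b → Reflects B b
Reflects-map to from (ofʸ a) = ofʸ (to a)
Reflects-map to from (ofⁿ ¬a) = ofⁿ (¬a ∘ from)

not∧≡true⁻ : ∀ {A : Set} {b c} → Reflects A b → not b ∧ c ≡ true → ¬ A × c ≡ true
not∧≡true⁻ (ofⁿ ¬a) c≡true = ¬a , c≡true
not∧≡true⁻ (ofʸ _) ()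

not∧≡true⁺ : ∀ {A : Set} {b c} → Reflects A b → ¬ A → c ≡ true → not b ∧ c ≡ true
not∧≡true⁺ (ofⁿ _) _ c≡true = c≡true
not∧≡true⁺ (ofʸ a) ¬a _ = ⊥-elim (¬a a)

-- Counting in finite lists

⟦_⟧ : Bool → ℕ
⟦ true ⟧ = 1
⟦ false ⟧ = 0

count : ∀ {A : Set} → (A → Bool) → List A → ℕ
count p xs = length (filterᵇ p xs)

record IsListing {A : Set} (xs : List A) : Set where
  field
    unique : Unique xs
    complete : ∀ x → x ∈ xs

open IsListing

module _ {A : Set} where

  count-∷ : ∀ (p : A → Bool) x xs → count p (x ∷ xs) ≡ ⟦ p x ⟧ + count p xs
  count-∷ p x xs with p x
  ... | true = refl
  ... | false = refl

  count-cong : ∀ {p q : A → Bool} xs → (∀ {x} → x ∈ xs → p x ≡ q x) → count p xs ≡ count q xs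
  count-cong [] _ = refl
  count-cong {p} {q} (x ∷ xs) p≗q = begin
    count p (x ∷ xs)        ≡⟨ count-∷ p x xs ⟩
    ⟦ p x ⟧ + count p xs    ≡⟨ cong₂ (λ b n → ⟦ b ⟧ + n) (p≗q (here refl)) (count-cong xs (p≗q ∘ there)) ⟩
    ⟦ q x ⟧ + count q xs    ≡⟨ sym (count-∷ q x xs) ⟩
    count q (x ∷ xs)        ∎

  count-const : ∀ b (xs : List A) → count (λ _ → b) xs ≡ ⟦ b ⟧ * length xs
  count-const b [] = sym (ℕₚ.*-zeroʳ ⟦ b ⟧)
  count-const b (x ∷ xs) = begin
    count (λ _ → b) (x ∷ xs)        ≡⟨ count-∷ (λ _ → b) x xs ⟩
    ⟦ b ⟧ + count (λ _ → b) xs      ≡⟨ cong (⟦ b ⟧ +_) (count-const b xs) ⟩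
    ⟦ b ⟧ + ⟦ b ⟧ * length xs       ≡⟨ sym (ℕₚ.*-suc ⟦ b ⟧ (length xs)) ⟩
    ⟦ b ⟧ * length (x ∷ xs)         ∎

  count-∧-const : ∀ (p : A → Bool) b xs → count (λ x → p x ∧ b) xs ≡ ⟦ b ⟧ * count p xs
  count-∧-const p true xs = trans (count-cong xs (λ {x} _ → Bool.∧-identityʳ (p x))) (sym (ℕₚ.+-identityʳ _))
  count-∧-const p false xs = trans (count-cong xs (λ {x} _ → Bool.∧-zeroʳ (p x))) (count-const false xs)

  count-remove : ∀ (p is : A → Bool) {x₀ xs} → (∀ x → Reflects (x ≡ x₀) (is x)) → Unique xs → x₀ ∈ xs →
                 count p xs ≡ ⟦ p x₀ ⟧ + count (λ x → not (is x) ∧ p x) xs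
  count-remove p is {x₀} {_ ∷ xs} reflects (x₀∉xs ∷ _) (here refl) = begin
    count p (x₀ ∷ xs)                          ≡⟨ count-∷ p x₀ xs ⟩
    ⟦ p x₀ ⟧ + count p xs
      ≡⟨ cong (⟦ p x₀ ⟧ +_) (count-cong xs λ x∈xs → sym (keep (All.lookup x₀∉xs x∈xs ∘ sym))) ⟩
    ⟦ p x₀ ⟧ + count p′ xs                     ≡⟨ cong (λ b → ⟦ p x₀ ⟧ + (⟦ not b ∧ p x₀ ⟧ + count p′ xs)) (sym is-x₀) ⟩
    ⟦ p x₀ ⟧ + (⟦ p′ x₀ ⟧ + count p′ xs)       ≡⟨ cong (⟦ p x₀ ⟧ +_) (sym (count-∷ p′ x₀ xs)) ⟩
    ⟦ p x₀ ⟧ + count p′ (x₀ ∷ xs)              ∎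
    where
    p′ = λ x → not (is x) ∧ p x
    is-x₀ : is x₀ ≡ true
    is-x₀ = det (reflects x₀) (ofʸ refl)
    keep : ∀ {x} → x ≢ x₀ → p′ x ≡ p x
    keep {x} x≢x₀ = cong (λ b → not b ∧ p x) (det (reflects x) (ofⁿ x≢x₀))
  count-remove p is {x₀} {x ∷ xs} reflects (x∉xs ∷ unique) (there x₀∈xs) = begin
    count p (x ∷ xs)                          ≡⟨ count-∷ p x xs ⟩
    ⟦ p x ⟧ + count p xs                      ≡⟨ cong (⟦ p x ⟧ +_) (count-remove p is reflects unique x₀∈xs) ⟩
    ⟦ p x ⟧ + (⟦ p x₀ ⟧ + count p′ xs)        ≡⟨ x∙yz≈y∙xz ⟦ p x ⟧ ⟦ p x₀ ⟧ (count p′ xs) ⟩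
    ⟦ p x₀ ⟧ + (⟦ p x ⟧ + count p′ xs)        ≡⟨ cong (λ b → ⟦ p x₀ ⟧ + (⟦ not b ∧ p x ⟧ + count p′ xs)) (sym is-x) ⟩
    ⟦ p x₀ ⟧ + (⟦ p′ x ⟧ + count p′ xs)       ≡⟨ cong (⟦ p x₀ ⟧ +_) (sym (count-∷ p′ x xs)) ⟩
    ⟦ p x₀ ⟧ + count p′ (x ∷ xs)              ∎
    where
    p′ = λ x → not (is x) ∧ p x
    is-x : is x ≡ false
    is-x = det (reflects x) (ofⁿ (All.lookup x∉xs x₀∈xs))

  any≡not[count≡ᵇ0] : ∀ (p : A → Bool) xs → any p xs ≡ not (count p xs ≡ᵇ 0)
  any≡not[count≡ᵇ0] p [] = refl
  any≡not[count≡ᵇ0] p (x ∷ xs) with p x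
  ... | true = refl
  ... | false = any≡not[count≡ᵇ0] p xs

  sum-⟦⟧* : ∀ (p : A → Bool) c xs → sum (map (λ x → ⟦ p x ⟧ * c) xs) ≡ count p xs * c
  sum-⟦⟧* p c [] = refl
  sum-⟦⟧* p c (x ∷ xs) = begin
    ⟦ p x ⟧ * c + sum (map (λ x → ⟦ p x ⟧ * c) xs)  ≡⟨ cong (⟦ p x ⟧ * c +_) (sum-⟦⟧* p c xs) ⟩
    ⟦ p x ⟧ * c + count p xs * c                   ≡⟨ sym (ℕₚ.*-distribʳ-+ c ⟦ p x ⟧ (count p xs)) ⟩
    (⟦ p x ⟧ + count p xs) * c                     ≡⟨ cong (_* c) (sym (count-∷ p x xs)) ⟩
    count p (x ∷ xs) * c                           ∎

count-map : ∀ {A B : Set} (p : B → Bool) (g : A → B) xs → count p (map g xs) ≡ count (p ∘ g) xs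
count-map p g [] = refl
count-map p g (x ∷ xs) = begin
  count p (g x ∷ map g xs)          ≡⟨ count-∷ p (g x) (map g xs) ⟩
  ⟦ p (g x) ⟧ + count p (map g xs)  ≡⟨ cong (⟦ p (g x) ⟧ +_) (count-map p g xs) ⟩
  ⟦ p (g x) ⟧ + count (p ∘ g) xs    ≡⟨ sym (count-∷ (p ∘ g) x xs) ⟩
  count (p ∘ g) (x ∷ xs)            ∎

module _ {A B : Set} where

  unique-map : ∀ {g : A → B} {xs} → (∀ {x x′} → x ∈ xs → x′ ∈ xs → g x ≡ g x′ → x ≡ x′) →
               Unique xs → Unique (map g xs)
  unique-map injective [] = []
  unique-map injective (x∉xs ∷ unique) =
    Allₚ.map⁺ (All.tabulate λ x′∈xs gx≡gx′ → All.lookup x∉xs x′∈xs (injective (here refl) (there x′∈xs) gx≡gx′))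
    ∷ unique-map (λ x∈xs x′∈xs → injective (there x∈xs) (there x′∈xs)) unique

  module _ {C : Set} (f : A → B → C) where

    concatMap≡cartesianProductWith : ∀ xs ys → concatMap (λ x → map (f x) ys) xs ≡ cartesianProductWith f xs ys
    concatMap≡cartesianProductWith [] ys = refl
    concatMap≡cartesianProductWith (x ∷ xs) ys = cong (map (f x) ys ++_) (concatMap≡cartesianProductWith xs ys)

    count-cartesianProductWith : ∀ (p : C → Bool) xs ys →
      count p (cartesianProductWith f xs ys) ≡ sum (map (λ x → count (p ∘ f x) ys) xs)
    count-cartesianProductWith p [] ys = refl
    count-cartesianProductWith p (x ∷ xs) ys = begin
      count p (map (f x) ys ++ cartesianProductWith f xs ys)
        ≡⟨ cong length (filter-++ (T? ∘ p) (map (f x) ys) _) ⟩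
      length (filterᵇ p (map (f x) ys) ++ filterᵇ p (cartesianProductWith f xs ys))
        ≡⟨ length-++ (filterᵇ p (map (f x) ys)) ⟩
      count p (map (f x) ys) + count p (cartesianProductWith f xs ys)
        ≡⟨ cong₂ _+_ (count-map p (f x) ys) (count-cartesianProductWith p xs ys) ⟩
      count (p ∘ f x) ys + sum (map (λ x → count (p ∘ f x) ys) xs) ∎

    length-cartesianProductWith : ∀ xs ys → length (cartesianProductWith f xs ys) ≡ length xs * length ys
    length-cartesianProductWith [] ys = refl
    length-cartesianProductWith (x ∷ xs) ys = begin
      length (map (f x) ys ++ cartesianProductWith f xs ys)    ≡⟨ length-++ (map (f x) ys) ⟩
      length (map (f x) ys) + length (cartesianProductWith f xs ys)
        ≡⟨ cong₂ _+_ (length-map (f x) ys) (length-cartesianProductWith xs ys) ⟩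
      length ys + length xs * length ys                        ∎

  module _ {xs : List A} {ys : List B} (p : A → Bool) (q : B → Bool) (g : A → B) where

    count-bijection : IsListing xs → IsListing ys →
      (∀ {x x′} → p x ≡ true → p x′ ≡ true → g x ≡ g x′ → x ≡ x′) →
      (∀ {x} → p x ≡ true → q (g x) ≡ true) →
      (∀ {y} → q y ≡ true → ∃[ x ] p x ≡ true × g x ≡ y) →
      count q ys ≡ count p xs
    count-bijection xs-listing ys-listing injective forth back = begin
      length (filterᵇ q ys)
        ≡⟨ ↭-length (∼bag⇒↭ (unique∧set⇒bag (filter⁺ (T? ∘ q) (unique ys-listing)) image-unique (mk⇔ to from))) ⟩
      length (map g (filterᵇ p xs))    ≡⟨ length-map g (filterᵇ p xs) ⟩
      length (filterᵇ p xs)            ∎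
      where
      satisfies : ∀ {x} → x ∈ filterᵇ p xs → p x ≡ true
      satisfies = Equivalence.to T-≡ ∘ proj₂ ∘ ∈-filter⁻ (T? ∘ p) {xs = xs}
      image-unique : Unique (map g (filterᵇ p xs))
      image-unique = unique-map (λ x∈ x′∈ → injective (satisfies x∈) (satisfies x′∈)) (filter⁺ (T? ∘ p) (unique xs-listing))
      to : ∀ {y} → y ∈ filterᵇ q ys → y ∈ map g (filterᵇ p xs)
      to y∈ with x , px , refl ← back (Equivalence.to T-≡ (proj₂ (∈-filter⁻ (T? ∘ q) {xs = ys} y∈))) =
        ∈-map∘filter⁺ g (T? ∘ p) (x , complete xs-listing x , refl , Equivalence.from T-≡ px)
      from : ∀ {y} → y ∈ map g (filterᵇ p xs) → y ∈ filterᵇ q ys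
      from y∈ with x , _ , refl , px ← ∈-map∘filter⁻ g (T? ∘ p) {xs = xs} y∈ =
        ∈-filter⁺ (T? ∘ q) (complete ys-listing (g x)) (Equivalence.from T-≡ (forth (Equivalence.to T-≡ px)))

cartesianProductWith-listing : ∀ {A B C : Set} (f : A → B → C) {xs ys} →
  (∀ {a a′ b b′} → f a b ≡ f a′ b′ → a ≡ a′ × b ≡ b′) → (∀ c → ∃₂ λ a b → f a b ≡ c) →
  IsListing xs → IsListing ys → IsListing (cartesianProductWith f xs ys)
cartesianProductWith-listing f {xs} {ys} f-injective f-surjective xs-listing ys-listing = record
  { unique = cartesianProductWith⁺ f f-injective (unique xs-listing) (unique ys-listing)
  ; complete = complete′ }
  where
  complete′ : ∀ c → c ∈ cartesianProductWith f xs ys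
  complete′ c with a , b , refl ← f-surjective c = ∈-cartesianProductWith⁺ f (complete xs-listing a) (complete ys-listing b)

-- The count is ⟦ p 2 ⟧ Σc + ⟦ p 1 ⟧ (length − Σc); the statement avoids truncated subtraction.
count-twoValued : ∀ {A : Set} (p : ℕ → Bool) (c : A → ℕ) xs → (∀ {x} → x ∈ xs → c x ≤ 1) →
  count (λ x → p (suc (c x))) xs + ⟦ p 1 ⟧ * sum (map c xs) ≡ ⟦ p 2 ⟧ * sum (map c xs) + ⟦ p 1 ⟧ * length xs
count-twoValued p c [] _ = solve 2 (λ a b → con 0 :+ a :* con 0 := b :* con 0 :+ a :* con 0) refl ⟦ p 1 ⟧ ⟦ p 2 ⟧
  where open +-*-Solver using (solve; con; _:+_; _:*_; _:=_)
count-twoValued p c (x ∷ xs) c≤1 = begin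
  count p′ (x ∷ xs) + a * (c x + S)                 ≡⟨ cong (_+ a * (c x + S)) (count-∷ p′ x xs) ⟩
  ⟦ p′ x ⟧ + count p′ xs + a * (c x + S)            ≡⟨ solve 5 (λ d n a m s → d :+ n :+ a :* (m :+ s) := (d :+ a :* m) :+ (n :+ a :* s))
                                                             refl ⟦ p′ x ⟧ (count p′ xs) a (c x) S ⟩
  (⟦ p′ x ⟧ + a * c x) + (count p′ xs + a * S)
    ≡⟨ cong₂ _+_ (single (c x) (c≤1 (here refl))) (count-twoValued p c xs (c≤1 ∘ there)) ⟩
  (b * c x + a) + (b * S + a * length xs)           ≡⟨ solve 5 (λ a b m s l → (b :* m :+ a) :+ (b :* s :+ a :* l) := b :* (m :+ s) :+ a :* (con 1 :+ l))
                                                             refl a b (c x) S (length xs) ⟩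
  b * (c x + S) + a * suc (length xs)               ∎
  where
  open +-*-Solver using (solve; con; _:+_; _:*_; _:=_)
  p′ = λ x → p (suc (c x))
  a = ⟦ p 1 ⟧
  b = ⟦ p 2 ⟧
  S = sum (map c xs)
  single : ∀ n → n ≤ 1 → ⟦ p (suc n) ⟧ + a * n ≡ b * n + a
  single zero _ = solve 2 (λ a b → a :+ a :* con 0 := b :* con 0 :+ a) refl a b
  single (suc zero) _ = solve 2 (λ a b → b :+ a :* con 1 := b :* con 1 :+ a) refl a b
  single (suc (suc _)) (s≤s ())

-- The tower F j of fields

F-isCommutativeRing : ∀ j → IsCommutativeRing _≡_ (_+F_ {j}) _*F_ id (zeroF j) (oneF j)
F-isCommutativeRing zero = isCommutativeRing-char2
  (λ { (bit a) (bit b) (bit c) → cong bit (Bool.xor-assoc a b c) })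
  (λ { (bit a) (bit b) → cong bit (Bool.xor-comm a b) })
  (λ { (bit a) → refl })
  (λ { (bit a) → cong bit (Bool.xor-same a) })
  (λ { (bit a) (bit b) (bit c) → cong bit (Bool.∧-assoc a b c) })
  (λ { (bit a) (bit b) → cong bit (Bool.∧-comm a b) })
  (λ { (bit a) → refl })
  (λ { (bit a) (bit b) (bit c) → cong bit (Bool.∧-distribʳ-xor a b c) })
F-isCommutativeRing (suc j) = isCommutativeRing-char2
  (λ { (pair a b) (pair c d) (pair e f) → cong₂ pair (+-assoc a c e) (+-assoc b d f) })
  (λ { (pair a b) (pair c d) → cong₂ pair (+-comm a c) (+-comm b d) })
  (λ { (pair a b) → cong₂ pair (+-identityˡ a) (+-identityˡ b) })
  (λ { (pair a b) → cong₂ pair (-‿inverseʳ a) (-‿inverseʳ b) })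
  (λ { (pair a b) (pair c d) (pair e f) → cong₂ pair
       (solve 7 (λ a b c d e f g → (a :* c :+ b :* d) :* e :+ (a :* d :+ b :* c :+ b :* d :* g) :* f
                                := a :* (c :* e :+ d :* f) :+ b :* (c :* f :+ d :* e :+ d :* f :* g))
              refl a b c d e f (gen j))
       (solve 7 (λ a b c d e f g → (a :* c :+ b :* d) :* f :+ (a :* d :+ b :* c :+ b :* d :* g) :* e
                                     :+ (a :* d :+ b :* c :+ b :* d :* g) :* f :* g
                                := a :* (c :* f :+ d :* e :+ d :* f :* g) :+ b :* (c :* e :+ d :* f)
                                     :+ b :* (c :* f :+ d :* e :+ d :* f :* g) :* g)
              refl a b c d e f (gen j)) })
  (λ { (pair a b) (pair c d) → cong₂ pair
       (solve 4 (λ a b c d → a :* c :+ b :* d := c :* a :+ d :* b) refl a b c d)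
       (solve 5 (λ a b c d g → a :* d :+ b :* c :+ b :* d :* g := c :* b :+ d :* a :+ d :* b :* g)
              refl a b c d (gen j)) })
  (λ { (pair a b) → cong₂ pair
       (solve 2 (λ a b → con true :* a :+ con false :* b := a) refl a b)
       (solve 3 (λ a b g → con true :* b :+ con false :* a :+ con false :* b :* g := b) refl a b (gen j)) })
  (λ { (pair a b) (pair c d) (pair e f) → cong₂ pair
       (solve 6 (λ a b c d e f → (c :+ e) :* a :+ (d :+ f) :* b := (c :* a :+ d :* b) :+ (e :* a :+ f :* b))
              refl a b c d e f)
       (solve 7 (λ a b c d e f g → (c :+ e) :* b :+ (d :+ f) :* a :+ (d :+ f) :* b :* g
                                := (c :* b :+ d :* a :+ d :* b :* g) :+ (e :* b :+ f :* a :+ f :* b :* g))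
              refl a b c d e f (gen j)) })
  where
  open IsCommutativeRing (F-isCommutativeRing j) using (+-assoc; +-comm; +-identityˡ; -‿inverseʳ)
  open Char2RingSolver (F-isCommutativeRing j)

module FRing (j : ℕ) where
  open IsCommutativeRing (F-isCommutativeRing j) public
    using (+-identityˡ; *-assoc; *-comm; *-identityˡ; *-identityʳ; zeroˡ; zeroʳ; distribʳ)
  open Char2RingSolver (F-isCommutativeRing j) public

pair-injective : ∀ {j} {a b c d : F j} → pair a b ≡ pair c d → a ≡ c × b ≡ d
pair-injective refl = refl , refl

isZeroᵇ-reflects : ∀ {j} (x : F j) → Reflects (x ≡ zeroF j) (isZeroᵇ x)
isZeroᵇ-reflects (bit false) = ofʸ refl
isZeroᵇ-reflects (bit true) = ofⁿ (λ ())
isZeroᵇ-reflects (pair a b) =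
  Reflects-map (λ { (refl , refl) → refl }) pair-injective (isZeroᵇ-reflects a ×-reflects isZeroᵇ-reflects b)

oneF≢zeroF : ∀ j → oneF j ≢ zeroF j
oneF≢zeroF zero ()
oneF≢zeroF (suc j) = oneF≢zeroF j ∘ proj₁ ∘ pair-injective

-- The absolute trace, computed through the tower from Tr_{F (suc j)/F j} (a + b X) = b x_j.
Tr : ∀ {j} → F j → Bool
Tr (bit b) = b
Tr {suc j} (pair a b) = Tr (b *F gen j)

Tr-+ : ∀ {j} (x y : F j) → Tr (x +F y) ≡ Tr x xor Tr y
Tr-+ (bit a) (bit b) = refl
Tr-+ {suc j} (pair a b) (pair c d) = trans (cong Tr (distribʳ (gen j) b d)) (Tr-+ (b *F gen j) (d *F gen j))
  where open FRing j

Tr[z²+z]≡false : ∀ {j} (z : F j) → Tr (z *F z +F z) ≡ false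
Tr[z²+z]≡false (bit false) = refl
Tr[z²+z]≡false (bit true) = refl
Tr[z²+z]≡false {suc j} (pair a b) = trans (cong Tr reduce) (Tr[z²+z]≡false (b *F gen j))
  where
  open FRing j
  reduce : (a *F b +F b *F a +F b *F b *F gen j +F b) *F gen j ≡ (b *F gen j) *F (b *F gen j) +F b *F gen j
  reduce = solve 3 (λ a b g → (a :* b :+ b :* a :+ b :* b :* g :+ b) :* g
                              := (b :* g) :* (b :* g) :+ b :* g)
                 refl a b (gen j)

Tr[z²]≡Tr[z] : ∀ {j} (z : F j) → Tr (z *F z) ≡ Tr z
Tr[z²]≡Tr[z] z with Tr (z *F z) | Tr z | trans (sym (Tr-+ (z *F z) z)) (Tr[z²+z]≡false z)
... | false | false | _ = refl
... | true | true | _ = refl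

Tr-gen : ∀ j → Tr (gen j) ≡ true
Tr-gen zero = refl
Tr-gen (suc j) = trans (cong Tr (*-identityˡ (gen j))) (Tr-gen j)
  where open FRing j

-- X⁻¹ = X + x_j, since X² + x_j X = 1.
gen⁻¹ : ∀ j → F j
gen⁻¹ zero = bit true
gen⁻¹ (suc j) = pair (gen j) (oneF j)

gen*gen⁻¹ : ∀ j → gen j *F gen⁻¹ j ≡ oneF j
gen*gen⁻¹ zero = refl
gen*gen⁻¹ (suc j) = cong₂ pair
  (solve 1 (λ g → con false :* g :+ con true :* con true := con true) refl (gen j))
  (solve 1 (λ g → con false :* con true :+ con true :* g :+ con true :* con true :* g := con false) refl (gen j))
  where open FRing j

Tr-gen⁻¹ : ∀ j → Tr (gen⁻¹ j) ≡ true
Tr-gen⁻¹ zero = refl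
Tr-gen⁻¹ (suc j) = Tr-gen (suc j)

module _ {j : ℕ} where
  open FRing j

  x+y≡0⇒x≡y : ∀ (x y : F j) → x +F y ≡ zeroF j → x ≡ y
  x+y≡0⇒x≡y x y e = begin
    x                 ≡⟨ solve 2 (λ x y → x := (x :+ y) :+ y) refl x y ⟩
    (x +F y) +F y     ≡⟨ cong (_+F y) e ⟩
    zeroF j +F y      ≡⟨ +-identityˡ y ⟩
    y                 ∎

-- X² + x_j X + 1 is irreducible over F j: a root y would give z = y x_j⁻¹ with z² + z = x_j⁻²,
-- but the trace of z² + z vanishes while Tr (x_j⁻²) = Tr (x_j⁻¹) = 1.
y²+gy≢1 : ∀ j (y : F j) → y *F y +F gen j *F y ≢ oneF j
y²+gy≢1 j y root = true≢false (begin
  true                ≡⟨ sym (Tr-gen⁻¹ j) ⟩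
  Tr h                ≡⟨ sym (Tr[z²]≡Tr[z] h) ⟩
  Tr (h *F h)         ≡⟨ cong Tr h²≡z²+z ⟩
  Tr (z *F z +F z)    ≡⟨ Tr[z²+z]≡false z ⟩
  false               ∎)
  where
  open FRing j
  h = gen⁻¹ j
  z = y *F h
  h²≡z²+z : h *F h ≡ z *F z +F z
  h²≡z²+z = begin
    h *F h                                  ≡⟨ sym (*-identityʳ _) ⟩
    h *F h *F oneF j                        ≡⟨ cong (h *F h *F_) (sym root) ⟩
    h *F h *F (y *F y +F gen j *F y)
      ≡⟨ solve 3 (λ h g y → h :* h :* (y :* y :+ g :* y)
                            := (y :* h) :* (y :* h) :+ (y :* h) :* (g :* h))
               refl h (gen j) y ⟩
    z *F z +F z *F (gen j *F h)             ≡⟨ cong (λ t → z *F z +F z *F t) (gen*gen⁻¹ j) ⟩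
    z *F z +F z *F oneF j                   ≡⟨ cong (z *F z +F_) (*-identityʳ z) ⟩
    z *F z +F z                             ∎
  true≢false : true ≢ false
  true≢false ()

norm : ∀ {j} → F j → F j → F j
norm {j} a b = a *F a +F a *F b *F gen j +F b *F b

-- (a + b X)⁻¹ = (a + b x_j + b X) / norm a b, multiplying by the conjugate X ↦ X + x_j.
inv : ∀ {j} → F j → F j
inv (bit b) = bit b
inv {suc j} (pair a b) = pair ((a +F b *F gen j) *F inv (norm a b)) (b *F inv (norm a b))

norm≢0 : ∀ j → (∀ (x : F j) → x ≢ zeroF j → x *F inv x ≡ oneF j) →
         ∀ a b → pair a b ≢ zeroF (suc j) → norm a b ≢ zeroF j
norm≢0 j inverse a b ab≢0 N≡0 with isZeroᵇ b | isZeroᵇ-reflects b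
... | true | ofʸ refl = a≢0 (begin
  a                          ≡⟨ sym (*-identityʳ a) ⟩
  a *F oneF j                ≡⟨ cong (a *F_) (sym (inverse a a≢0)) ⟩
  a *F (a *F inv a)
    ≡⟨ solve 3 (λ a a⁻¹ g → a :* (a :* a⁻¹)
                            := (a :* a :+ a :* con false :* g :+ con false :* con false) :* a⁻¹)
             refl a (inv a) (gen j) ⟩
  norm a (zeroF j) *F inv a  ≡⟨ cong (_*F inv a) N≡0 ⟩
  zeroF j *F inv a           ≡⟨ zeroˡ (inv a) ⟩
  zeroF j                    ∎)
  where
  open FRing j
  a≢0 : a ≢ zeroF j
  a≢0 refl = ab≢0 refl
... | false | ofⁿ b≢0 = y²+gy≢1 j y (x+y≡0⇒x≡y _ _ (begin
  y *F y +F gen j *F y +F oneF j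
    ≡⟨ cong₂ (λ s t → y *F y +F s +F t)
             (sym (trans (cong (gen j *F y *F_) bb⁻¹≡1) (*-identityʳ _)))
             (sym (trans (cong₂ _*F_ bb⁻¹≡1 bb⁻¹≡1) (*-identityˡ _))) ⟩
  y *F y +F gen j *F y *F (b *F b⁻¹) +F (b *F b⁻¹) *F (b *F b⁻¹)
    ≡⟨ solve 4 (λ a b b⁻¹ g → (a :* b⁻¹) :* (a :* b⁻¹) :+ g :* (a :* b⁻¹) :* (b :* b⁻¹) :+ (b :* b⁻¹) :* (b :* b⁻¹)
                              := (a :* a :+ a :* b :* g :+ b :* b) :* (b⁻¹ :* b⁻¹))
             refl a b b⁻¹ (gen j) ⟩
  norm a b *F (b⁻¹ *F b⁻¹)                                       ≡⟨ cong (_*F (b⁻¹ *F b⁻¹)) N≡0 ⟩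
  zeroF j *F (b⁻¹ *F b⁻¹)                                        ≡⟨ zeroˡ _ ⟩
  zeroF j                                                        ∎))
  where
  open FRing j
  b⁻¹ = inv b
  y = a *F b⁻¹
  bb⁻¹≡1 : b *F b⁻¹ ≡ oneF j
  bb⁻¹≡1 = inverse b b≢0

*-inverseʳ : ∀ j (x : F j) → x ≢ zeroF j → x *F inv x ≡ oneF j
*-inverseʳ zero (bit false) x≢0 = ⊥-elim (x≢0 refl)
*-inverseʳ zero (bit true) _ = refl
*-inverseʳ (suc j) (pair a b) x≢0 = cong₂ pair
  (begin
    a *F ((a +F b *F gen j) *F n) +F b *F (b *F n)
      ≡⟨ solve 4 (λ a b g n → a :* ((a :+ b :* g) :* n) :+ b :* (b :* n)
                              := (a :* a :+ a :* b :* g :+ b :* b) :* n)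
               refl a b (gen j) n ⟩
    norm a b *F n                                  ≡⟨ *-inverseʳ j (norm a b) (norm≢0 j (*-inverseʳ j) a b x≢0) ⟩
    oneF j                                         ∎)
  (solve 4 (λ a b g n → a :* (b :* n) :+ b :* ((a :+ b :* g) :* n) :+ b :* (b :* n) :* g
                        := con false)
         refl a b (gen j) n)
  where
  open FRing j
  n = inv (norm a b)

module _ {j : ℕ} where
  open FRing j

  *-inverseˡ : ∀ (x : F j) → x ≢ zeroF j → inv x *F x ≡ oneF j
  *-inverseˡ x x≢0 = trans (*-comm (inv x) x) (*-inverseʳ j x x≢0)

  x⁻¹*[x*y]≡y : ∀ {x} → x ≢ zeroF j → ∀ y → inv x *F (x *F y) ≡ y
  x⁻¹*[x*y]≡y {x} x≢0 y = begin
    inv x *F (x *F y)   ≡⟨ sym (*-assoc (inv x) x y) ⟩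
    inv x *F x *F y     ≡⟨ cong (_*F y) (*-inverseˡ x x≢0) ⟩
    oneF j *F y         ≡⟨ *-identityˡ y ⟩
    y                   ∎

  x*[x⁻¹*y]≡y : ∀ {x} → x ≢ zeroF j → ∀ y → x *F (inv x *F y) ≡ y
  x*[x⁻¹*y]≡y {x} x≢0 y = begin
    x *F (inv x *F y)   ≡⟨ sym (*-assoc x (inv x) y) ⟩
    x *F inv x *F y     ≡⟨ cong (_*F y) (*-inverseʳ j x x≢0) ⟩
    oneF j *F y         ≡⟨ *-identityˡ y ⟩
    y                   ∎

  *-cancelˡ : ∀ (l : F j) {a b} → l ≢ zeroF j → l *F a ≡ l *F b → a ≡ b
  *-cancelˡ l {a} {b} l≢0 la≡lb = begin
    a                    ≡⟨ sym (x⁻¹*[x*y]≡y l≢0 a) ⟩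
    inv l *F (l *F a)    ≡⟨ cong (inv l *F_) la≡lb ⟩
    inv l *F (l *F b)    ≡⟨ x⁻¹*[x*y]≡y l≢0 b ⟩
    b                    ∎

  *-cancelʳ : ∀ (l : F j) {a b} → l ≢ zeroF j → a *F l ≡ b *F l → a ≡ b
  *-cancelʳ l {a} {b} l≢0 al≡bl = *-cancelˡ l l≢0 (trans (*-comm l a) (trans al≡bl (*-comm b l)))

  +-cancelʳ : ∀ (c : F j) {a b} → a +F c ≡ b +F c → a ≡ b
  +-cancelʳ c {a} {b} ac≡bc = begin
    a              ≡⟨ solve 2 (λ a c → a := a :+ c :+ c) refl a c ⟩
    a +F c +F c    ≡⟨ cong (_+F c) ac≡bc ⟩
    b +F c +F c    ≡⟨ solve 2 (λ b c → b :+ c :+ c := b) refl b c ⟩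
    b              ∎

-- Vectors, matrices and coordinates over F j

module _ {j : ℕ} where
  open FRing j

  scale-assoc : ∀ (a b : F j) (v : V2 j) → scale a (scale b v) ≡ scale (a *F b) v
  scale-assoc a b (x , y) = cong₂ _,_ (sym (*-assoc a b x)) (sym (*-assoc a b y))

  scale-identity : ∀ (v : V2 j) → scale (oneF j) v ≡ v
  scale-identity (x , y) = cong₂ _,_ (*-identityˡ x) (*-identityˡ y)

  scale-zero : ∀ (l : F j) → scale l (zeroF j , zeroF j) ≡ (zeroF j , zeroF j)
  scale-zero l = cong₂ _,_ (zeroʳ l) (zeroʳ l)

  scale-cancel : ∀ (l : F j) {v w : V2 j} → l ≢ zeroF j → scale l v ≡ scale l w → v ≡ w
  scale-cancel l {x , y} {x′ , y′} l≢0 lv≡lw =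
    cong₂ _,_ (*-cancelˡ l l≢0 (cong proj₁ lv≡lw)) (*-cancelˡ l l≢0 (cong proj₂ lv≡lw))

  applyM-scale : ∀ (A : Mat j) (a : F j) (v : V2 j) → applyM A (scale a v) ≡ scale a (applyM A v)
  applyM-scale (mat a b c d) l (x , y) = cong₂ _,_
    (solve 5 (λ a b l x y → a :* (l :* x) :+ b :* (l :* y) := l :* (a :* x :+ b :* y)) refl a b l x y)
    (solve 5 (λ c d l x y → c :* (l :* x) :+ d :* (l :* y) := l :* (c :* x :+ d :* y)) refl c d l x y)

  adj : Mat j → Mat j
  adj (mat a b c d) = mat d b c a

  applyM-adj-applyM : ∀ (A : Mat j) (v : V2 j) → applyM (adj A) (applyM A v) ≡ scale (detM A) v
  applyM-adj-applyM (mat a b c d) (x , y) = cong₂ _,_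
    (solve 6 (λ a b c d x y → d :* (a :* x :+ b :* y) :+ b :* (c :* x :+ d :* y)
                              := (a :* d :+ b :* c) :* x)
           refl a b c d x y)
    (solve 6 (λ a b c d x y → c :* (a :* x :+ b :* y) :+ a :* (c :* x :+ d :* y)
                              := (a :* d :+ b :* c) :* y)
           refl a b c d x y)

  applyM-applyM-adj : ∀ (A : Mat j) (v : V2 j) → applyM A (applyM (adj A) v) ≡ scale (detM A) v
  applyM-applyM-adj (mat a b c d) (x , y) = cong₂ _,_
    (solve 6 (λ a b c d x y → a :* (d :* x :+ b :* y) :+ b :* (c :* x :+ a :* y)
                              := (a :* d :+ b :* c) :* x)
           refl a b c d x y)
    (solve 6 (λ a b c d x y → c :* (d :* x :+ b :* y) :+ d :* (c :* x :+ a :* y)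
                              := (a :* d :+ b :* c) :* y)
           refl a b c d x y)

  applyM-injective : ∀ (A : Mat j) → detM A ≢ zeroF j → ∀ {v w} → applyM A v ≡ applyM A w → v ≡ w
  applyM-injective A det≢0 {v} {w} Av≡Aw = scale-cancel (detM A) det≢0 (begin
    scale (detM A) v              ≡⟨ sym (applyM-adj-applyM A v) ⟩
    applyM (adj A) (applyM A v)   ≡⟨ cong (applyM (adj A)) Av≡Aw ⟩
    applyM (adj A) (applyM A w)   ≡⟨ applyM-adj-applyM A w ⟩
    scale (detM A) w              ∎)

  applyM-surjective : ∀ (A : Mat j) → detM A ≢ zeroF j → ∀ v → ∃[ w ] applyM A w ≡ v
  applyM-surjective A det≢0 v = scale (inv (detM A)) (applyM (adj A) v) , (begin
    applyM A (scale (inv (detM A)) (applyM (adj A) v))   ≡⟨ applyM-scale A _ _ ⟩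
    scale (inv (detM A)) (applyM A (applyM (adj A) v))   ≡⟨ cong (scale _) (applyM-applyM-adj A v) ⟩
    scale (inv (detM A)) (scale (detM A) v)              ≡⟨ scale-assoc _ _ v ⟩
    scale (inv (detM A) *F detM A) v                     ≡⟨ cong (λ l → scale l v) (*-inverseˡ (detM A) det≢0) ⟩
    scale (oneF j) v                                     ≡⟨ scale-identity v ⟩
    v                                                    ∎)

  ι*pair : ∀ (a s t : F j) → ι a *F pair s t ≡ pair (a *F s) (a *F t)
  ι*pair a s t = cong₂ pair
    (solve 3 (λ a s t → a :* s :+ con false :* t := a :* s) refl a s t)
    (solve 4 (λ a s t g → a :* t :+ con false :* s :+ con false :* t :* g := a :* t) refl a s t (gen j))

  -- Coordinates in {1, ξ}, which is an F j-basis of F (suc j) exactly when ξ ∉ F j, i.e. when the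
  -- X-coordinate ξ₁ of ξ is nonzero.
  fromBasis : F (suc j) → V2 j → F (suc j)
  fromBasis ξ (x , y) = ι x +F ξ *F ι y

  fromBasis-pair : ∀ (ξ₀ ξ₁ x y : F j) → fromBasis (pair ξ₀ ξ₁) (x , y) ≡ pair (x +F ξ₀ *F y) (ξ₁ *F y)
  fromBasis-pair ξ₀ ξ₁ x y = cong₂ pair
    (solve 4 (λ x ξ₀ ξ₁ y → x :+ (ξ₀ :* y :+ ξ₁ :* con false) := x :+ ξ₀ :* y) refl x ξ₀ ξ₁ y)
    (solve 5 (λ x ξ₀ ξ₁ y g → con false :+ (ξ₀ :* con false :+ ξ₁ :* y :+ ξ₁ :* con false :* g) := ξ₁ :* y)
           refl x ξ₀ ξ₁ y (gen j))

  fromBasis-scale : ∀ (ξ : F (suc j)) (a : F j) (v : V2 j) → fromBasis ξ (scale a v) ≡ ι a *F fromBasis ξ v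
  fromBasis-scale (pair ξ₀ ξ₁) a (x , y) = begin
    fromBasis (pair ξ₀ ξ₁) (a *F x , a *F y)        ≡⟨ fromBasis-pair ξ₀ ξ₁ _ _ ⟩
    pair (a *F x +F ξ₀ *F (a *F y)) (ξ₁ *F (a *F y))  ≡⟨ cong₂ pair
      (solve 4 (λ a x ξ₀ y → a :* x :+ ξ₀ :* (a :* y) := a :* (x :+ ξ₀ :* y)) refl a x ξ₀ y)
      (solve 3 (λ a ξ₁ y → ξ₁ :* (a :* y) := a :* (ξ₁ :* y)) refl a ξ₁ y) ⟩
    pair (a *F (x +F ξ₀ *F y)) (a *F (ξ₁ *F y))      ≡⟨ sym (ι*pair a _ _) ⟩
    ι a *F pair (x +F ξ₀ *F y) (ξ₁ *F y)            ≡⟨ cong (ι a *F_) (sym (fromBasis-pair ξ₀ ξ₁ x y)) ⟩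
    ι a *F fromBasis (pair ξ₀ ξ₁) (x , y)           ∎

  ξ₁≢0 : ∀ {ξ₀ ξ₁} → (∀ a → pair ξ₀ ξ₁ ≢ ι a) → ξ₁ ≢ zeroF j
  ξ₁≢0 {ξ₀} ξ∉F refl = ξ∉F ξ₀ refl

  fromBasis-injective : ∀ {ξ} → (∀ a → ξ ≢ ι a) → ∀ {v w} → fromBasis ξ v ≡ fromBasis ξ w → v ≡ w
  fromBasis-injective {pair ξ₀ ξ₁} ξ∉F {x , y} {x′ , y′} eq = cong₂ _,_ x≡x′ y≡y′
    where
    coordinates = pair-injective (trans (sym (fromBasis-pair ξ₀ ξ₁ x y)) (trans eq (fromBasis-pair ξ₀ ξ₁ x′ y′)))
    y≡y′ : y ≡ y′
    y≡y′ = *-cancelˡ ξ₁ (ξ₁≢0 ξ∉F) (proj₂ coordinates)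
    x≡x′ : x ≡ x′
    x≡x′ = +-cancelʳ (ξ₀ *F y) (trans (proj₁ coordinates) (cong (λ t → x′ +F ξ₀ *F t) (sym y≡y′)))

  fromBasis-surjective : ∀ {ξ} → (∀ a → ξ ≢ ι a) → ∀ z → ∃[ v ] fromBasis ξ v ≡ z
  fromBasis-surjective {pair ξ₀ ξ₁} ξ∉F (pair s t) = (s +F ξ₀ *F y , y) , (begin
    fromBasis (pair ξ₀ ξ₁) (s +F ξ₀ *F y , y)       ≡⟨ fromBasis-pair ξ₀ ξ₁ _ _ ⟩
    pair (s +F ξ₀ *F y +F ξ₀ *F y) (ξ₁ *F y)
      ≡⟨ cong₂ pair (solve 3 (λ s ξ₀ y → s :+ ξ₀ :* y :+ ξ₀ :* y := s) refl s ξ₀ y) ξ₁y≡t ⟩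
    pair s t                                       ∎)
    where
    y = inv ξ₁ *F t
    ξ₁y≡t : ξ₁ *F y ≡ t
    ξ₁y≡t = x*[x⁻¹*y]≡y (ξ₁≢0 ξ∉F) t

∣F∣ : ℕ → ℕ
∣F∣ j = 2 ^ 2 ^ j

elems≡cartesianProduct : ∀ j → elems (suc j) ≡ cartesianProductWith pair (elems j) (elems j)
elems≡cartesianProduct j = concatMap≡cartesianProductWith pair (elems j) (elems j)

elems-listing : ∀ j → IsListing (elems j)
elems-listing zero = record
  { unique = ((λ ()) ∷ []) ∷ [] ∷ []
  ; complete = λ { (bit false) → here refl ; (bit true) → there (here refl) } }
elems-listing (suc j) = subst IsListing (sym (elems≡cartesianProduct j))
  (cartesianProductWith-listing pair (λ { refl → refl , refl }) (λ { (pair a b) → a , b , refl })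
    (elems-listing j) (elems-listing j))

length-elems : ∀ j → length (elems j) ≡ ∣F∣ j
length-elems zero = refl
length-elems (suc j) = begin
  length (elems (suc j))                                  ≡⟨ cong length (elems≡cartesianProduct j) ⟩
  length (cartesianProductWith pair (elems j) (elems j))  ≡⟨ length-cartesianProductWith pair (elems j) (elems j) ⟩
  length (elems j) * length (elems j)                     ≡⟨ cong₂ _*_ (length-elems j) (length-elems j) ⟩
  2 ^ 2 ^ j * 2 ^ 2 ^ j                                   ≡⟨ sym (ℕₚ.^-distribˡ-+-* 2 (2 ^ j) (2 ^ j)) ⟩
  2 ^ (2 ^ j + 2 ^ j)                                     ≡⟨ cong (λ n → 2 ^ (2 ^ j + n)) (sym (ℕₚ.+-identityʳ (2 ^ j))) ⟩
  ∣F∣ (suc j)                                             ∎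

allV2-listing : ∀ j → IsListing (allV2 j)
allV2-listing j = subst IsListing (sym (concatMap≡cartesianProductWith _,_ (elems j) (elems j)))
  (cartesianProductWith-listing _,_ (λ { refl → refl , refl }) (λ { (a , b) → a , b , refl })
    (elems-listing j) (elems-listing j))

points-listing : ∀ j → IsListing (points j)
points-listing j = record
  { unique = All.tabulate (λ { m refl → case ∈-map⁻ just m of λ { (_ , _ , ()) } })
             ∷ unique-map (λ { _ _ refl → refl }) (unique (elems-listing j))
  ; complete = λ { nothing → here refl ; (just a) → there (∈-map⁺ just (complete (elems-listing j) a)) } }

points×F-listing : ∀ j → IsListing (cartesianProduct (points j) (elems j))
points×F-listing j = cartesianProductWith-listing _,_ (λ { refl → refl , refl }) (λ { (P , l) → P , l , refl })
  (points-listing j) (elems-listing j)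

-- Points of PG(1, q) and their weights

isZeroVᵇ : ∀ {j} → V2 j → Bool
isZeroVᵇ (x , y) = isZeroᵇ x ∧ isZeroᵇ y

isZeroVᵇ-reflects : ∀ {j} (v : V2 j) → Reflects (v ≡ (zeroF j , zeroF j)) (isZeroVᵇ v)
isZeroVᵇ-reflects (x , y) =
  Reflects-map (λ { (refl , refl) → refl }) (λ { refl → refl , refl }) (isZeroᵇ-reflects x ×-reflects isZeroᵇ-reflects y)

module _ {j : ℕ} where
  open FRing j

  rep≢0 : ∀ (P : Point j) → rep P ≢ (zeroF j , zeroF j)
  rep≢0 nothing = oneF≢zeroF j ∘ cong proj₂
  rep≢0 (just a) = oneF≢zeroF j ∘ cong proj₁

  scale-rep≢0 : ∀ (P : Point j) {l} → l ≢ zeroF j → scale l (rep P) ≢ (zeroF j , zeroF j)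
  scale-rep≢0 P {l} l≢0 lP≡0 = rep≢0 P (scale-cancel l l≢0 (trans lP≡0 (sym (scale-zero l))))

  scale-rep-injective : ∀ {P P′ : Point j} {l l′} → l ≢ zeroF j → l′ ≢ zeroF j →
                        scale l (rep P) ≡ scale l′ (rep P′) → (P , l) ≡ (P′ , l′)
  scale-rep-injective {nothing} {nothing} {l} {l′} _ _ eq =
    cong (nothing ,_) (trans (sym (*-identityʳ l)) (trans (cong proj₂ eq) (*-identityʳ l′)))
  scale-rep-injective {nothing} {just _} {l} {l′} _ l′≢0 eq =
    ⊥-elim (l′≢0 (trans (sym (*-identityʳ l′)) (trans (sym (cong proj₁ eq)) (zeroʳ l))))
  scale-rep-injective {just _} {nothing} {l} {l′} l≢0 _ eq =
    ⊥-elim (l≢0 (trans (sym (*-identityʳ l)) (trans (cong proj₁ eq) (zeroʳ l′))))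
  scale-rep-injective {just a} {just a′} {l} {l′} l≢0 _ eq
    with refl ← trans (sym (*-identityʳ l)) (trans (cong proj₁ eq) (*-identityʳ l′)) =
    cong (λ b → just b , l) (*-cancelˡ l l≢0 (cong proj₂ eq))

  scale-rep-surjective : ∀ (v : V2 j) → v ≢ (zeroF j , zeroF j) →
                         ∃₂ λ (P : Point j) l → l ≢ zeroF j × scale l (rep P) ≡ v
  scale-rep-surjective (c , d) v≢0 with isZeroᵇ c | isZeroᵇ-reflects c
  ... | true | ofʸ refl = nothing , d , (λ { refl → v≢0 refl }) , cong₂ _,_ (zeroʳ d) (*-identityʳ d)
  ... | false | ofⁿ c≢0 = just (inv c *F d) , c , c≢0 , cong₂ _,_ (*-identityʳ c) (x*[x⁻¹*y]≡y c≢0 d)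

-- wcard U P is spanCard U (rep P), and nWeight U w is nPoints U (_≡ᵇ 2 ^ w).
spanCard : ∀ {j} → Sub j → V2 j → ℕ
spanCard {j} U v = count (λ l → U (scale l v)) (elems j)

nPoints : ∀ {j} → Sub j → (ℕ → Bool) → ℕ
nPoints {j} U p = count (λ P → p (wcard U P)) (points j)

module _ {j : ℕ} where
  open FRing j

  spanCard-scale : ∀ (U : Sub j) {l} v → l ≢ zeroF j → spanCard U (scale l v) ≡ spanCard U v
  spanCard-scale U {l} v l≢0 = sym (count-bijection (λ a → U (scale a (scale l v))) (λ b → U (scale b v)) (_*F l)
    (elems-listing j) (elems-listing j) (λ _ _ → *-cancelʳ l l≢0) forth back)
    where
    forth : ∀ {a} → U (scale a (scale l v)) ≡ true → U (scale (a *F l) v) ≡ true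
    forth {a} = trans (cong U (sym (scale-assoc a l v)))
    l⁻¹b*l≡b : ∀ b → inv l *F b *F l ≡ b
    l⁻¹b*l≡b b = trans (*-comm (inv l *F b) l) (x*[x⁻¹*y]≡y l≢0 b)
    back : ∀ {b} → U (scale b v) ≡ true → ∃[ a ] U (scale a (scale l v)) ≡ true × a *F l ≡ b
    back {b} bv∈U = inv l *F b , trans (cong U (trans (scale-assoc _ l v) (cong (λ c → scale c v) (l⁻¹b*l≡b b)))) bv∈U , l⁻¹b*l≡b b

  count-nonzeroVectors : ∀ (R : V2 j → Bool) →
    count (λ v → not (isZeroVᵇ v) ∧ R v) (allV2 j) ≡
    sum (map (λ P → count (λ l → not (isZeroᵇ l) ∧ R (scale l (rep P))) (elems j)) (points j))
  count-nonzeroVectors R = begin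
    count q (allV2 j)
      ≡⟨ count-bijection p q g (points×F-listing j) (allV2-listing j) injective (λ {x} → forth {x}) back ⟩
    count p (cartesianProduct (points j) (elems j))  ≡⟨ count-cartesianProductWith _,_ p (points j) (elems j) ⟩
    sum (map (λ P → count (λ l → not (isZeroᵇ l) ∧ R (scale l (rep P))) (elems j)) (points j)) ∎
    where
    g : Point j × F j → V2 j
    g (P , l) = scale l (rep P)
    p : Point j × F j → Bool
    p (P , l) = not (isZeroᵇ l) ∧ R (g (P , l))
    q : V2 j → Bool
    q v = not (isZeroVᵇ v) ∧ R v
    scalar≢0 : ∀ {x} → p x ≡ true → proj₂ x ≢ zeroF j
    scalar≢0 {P , l} px = proj₁ (not∧≡true⁻ (isZeroᵇ-reflects l) px)
    injective : ∀ {x x′} → p x ≡ true → p x′ ≡ true → g x ≡ g x′ → x ≡ x′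
    injective {P , l} {P′ , l′} px px′ = scale-rep-injective {P = P} {P′ = P′} (scalar≢0 {P , l} px) (scalar≢0 {P′ , l′} px′)
    forth : ∀ {x} → p x ≡ true → q (g x) ≡ true
    forth {P , l} px =
      let (l≢0 , R[lP]) = not∧≡true⁻ (isZeroᵇ-reflects l) px
      in not∧≡true⁺ (isZeroVᵇ-reflects _) (scale-rep≢0 P l≢0) R[lP]
    back : ∀ {v} → q v ≡ true → ∃[ x ] p x ≡ true × g x ≡ v
    back {v} qv =
      let (v≢0 , Rv) = not∧≡true⁻ (isZeroVᵇ-reflects v) qv
          (P , l , l≢0 , lP≡v) = scale-rep-surjective v v≢0
      in (P , l) , not∧≡true⁺ (isZeroᵇ-reflects l) l≢0 (trans (cong R lP≡v) Rv) , lP≡v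

  count-removeZero : ∀ (p : F j → Bool) → count p (elems j) ≡ ⟦ p (zeroF j) ⟧ + count (λ l → not (isZeroᵇ l) ∧ p l) (elems j)
  count-removeZero p = count-remove p isZeroᵇ isZeroᵇ-reflects (unique (elems-listing j)) (complete (elems-listing j) (zeroF j))

  count-removeZeroV : ∀ (p : V2 j → Bool) →
    count p (allV2 j) ≡ ⟦ p (zeroF j , zeroF j) ⟧ + count (λ v → not (isZeroVᵇ v) ∧ p v) (allV2 j)
  count-removeZeroV p = count-remove p isZeroVᵇ isZeroVᵇ-reflects (unique (allV2-listing j)) (complete (allV2-listing j) _)

  count-nonzeroScalars : count (λ l → not (isZeroᵇ l)) (elems j) ≡ ∣F∣ j ∸ 1
  count-nonzeroScalars = begin
    count (λ l → not (isZeroᵇ l)) (elems j)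
      ≡⟨ count-cong (elems j) (λ {l} _ → sym (Bool.∧-identityʳ (not (isZeroᵇ l)))) ⟩
    suc (count (λ l → not (isZeroᵇ l) ∧ true) (elems j)) ∸ 1
      ≡⟨ cong (_∸ 1) (sym (count-removeZero (λ _ → true))) ⟩
    count (λ _ → true) (elems j) ∸ 1                 ≡⟨ cong (_∸ 1) (trans (count-const true (elems j)) (ℕₚ.*-identityˡ _)) ⟩
    length (elems j) ∸ 1                             ≡⟨ cong (_∸ 1) (length-elems j) ⟩
    ∣F∣ j ∸ 1                                        ∎

  module _ (U : Sub j) (0∈U : U (zeroF j , zeroF j) ≡ true) where

    spanCard-zero : spanCard U (zeroF j , zeroF j) ≡ ∣F∣ j
    spanCard-zero = begin
      count (λ l → U (scale l (zeroF j , zeroF j))) (elems j)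
        ≡⟨ count-cong (elems j) (λ {l} _ → trans (cong U (scale-zero l)) 0∈U) ⟩
      count (λ _ → true) (elems j)                            ≡⟨ count-const true (elems j) ⟩
      1 * length (elems j)                                    ≡⟨ ℕₚ.*-identityˡ _ ⟩
      length (elems j)                                        ≡⟨ length-elems j ⟩
      ∣F∣ j                                                   ∎

    wcard≡suc : ∀ P → wcard U P ≡ suc (count (λ l → not (isZeroᵇ l) ∧ U (scale l (rep P))) (elems j))
    wcard≡suc P = begin
      wcard U P
        ≡⟨ count-removeZero (λ l → U (scale l (rep P))) ⟩
      ⟦ U (scale (zeroF j) (rep P)) ⟧ + count (λ l → not (isZeroᵇ l) ∧ U (scale l (rep P))) (elems j)
        ≡⟨ cong (λ b → ⟦ b ⟧ + count (λ l → not (isZeroᵇ l) ∧ U (scale l (rep P))) (elems j)) (trans (cong U (cong₂ _,_ (zeroˡ _) (zeroˡ _))) 0∈U) ⟩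
      suc (count (λ l → not (isZeroᵇ l) ∧ U (scale l (rep P))) (elems j)) ∎

    count-spanCard : ∀ (p : ℕ → Bool) → count (λ v → p (spanCard U v)) (allV2 j) ≡ ⟦ p (∣F∣ j) ⟧ + nPoints U p * (∣F∣ j ∸ 1)
    count-spanCard p = begin
      count (p ∘ spanCard U) (allV2 j)
        ≡⟨ count-removeZeroV (p ∘ spanCard U) ⟩
      ⟦ p (spanCard U (zeroF j , zeroF j)) ⟧ + count (λ v → not (isZeroVᵇ v) ∧ p (spanCard U v)) (allV2 j)
        ≡⟨ cong₂ (λ n m → ⟦ p n ⟧ + m) spanCard-zero (count-nonzeroVectors (p ∘ spanCard U)) ⟩
      ⟦ p (∣F∣ j) ⟧ + sum (map (λ P → count (λ l → not (isZeroᵇ l) ∧ p (spanCard U (scale l (rep P)))) (elems j)) (points j))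
        ≡⟨ cong (λ n → ⟦ p (∣F∣ j) ⟧ + sum n) (map-cong per-point (points j)) ⟩
      ⟦ p (∣F∣ j) ⟧ + sum (map (λ P → ⟦ p (wcard U P) ⟧ * (∣F∣ j ∸ 1)) (points j))
        ≡⟨ cong (⟦ p (∣F∣ j) ⟧ +_) (sum-⟦⟧* (p ∘ wcard U) (∣F∣ j ∸ 1) (points j)) ⟩
      ⟦ p (∣F∣ j) ⟧ + nPoints U p * (∣F∣ j ∸ 1) ∎
      where
      scale-invariant : ∀ P l → not (isZeroᵇ l) ∧ p (spanCard U (scale l (rep P))) ≡ not (isZeroᵇ l) ∧ p (wcard U P)
      scale-invariant P l with isZeroᵇ l | isZeroᵇ-reflects l
      ... | true | _ = refl
      ... | false | ofⁿ l≢0 = cong p (spanCard-scale U (rep P) l≢0)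
      per-point : ∀ P → count (λ l → not (isZeroᵇ l) ∧ p (spanCard U (scale l (rep P)))) (elems j) ≡ ⟦ p (wcard U P) ⟧ * (∣F∣ j ∸ 1)
      per-point P = begin
        count (λ l → not (isZeroᵇ l) ∧ p (spanCard U (scale l (rep P)))) (elems j)
          ≡⟨ count-cong (elems j) (λ {l} _ → scale-invariant P l) ⟩
        count (λ l → not (isZeroᵇ l) ∧ p (wcard U P)) (elems j)
          ≡⟨ count-∧-const (not ∘ isZeroᵇ) (p (wcard U P)) (elems j) ⟩
        ⟦ p (wcard U P) ⟧ * count (λ l → not (isZeroᵇ l)) (elems j)
          ≡⟨ cong (⟦ p (wcard U P) ⟧ *_) count-nonzeroScalars ⟩
        ⟦ p (wcard U P) ⟧ * (∣F∣ j ∸ 1)                                              ∎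

sizeL≡nPoints : ∀ {j} (U : Sub j) → U (zeroF j , zeroF j) ≡ true → sizeL U ≡ nPoints U (λ n → not (n ≡ᵇ 1))
sizeL≡nPoints {j} U 0∈U = count-cong (points j) λ {P} _ → begin
  inLᵇ U P                                                                  ≡⟨ any≡not[count≡ᵇ0] _ (elems j) ⟩
  not (count (λ l → not (isZeroᵇ l) ∧ U (scale l (rep P))) (elems j) ≡ᵇ 0)
    ≡⟨ cong (λ n → not (n ≡ᵇ 1)) (sym (wcard≡suc U 0∈U P)) ⟩
  not (wcard U P ≡ᵇ 1)                                                      ∎

-- The Ψ construction

evalLin-zero : ∀ {j} (f : LinPoly j) → evalLin f (zeroF j) ≡ zeroF j
evalLin-zero [] = refl
evalLin-zero {j} (a ∷ as) = begin
  a *F zeroF j +F evalLin as (zeroF j *F zeroF j)  ≡⟨ cong₂ _+F_ (zeroʳ a) (cong (evalLin as) (zeroˡ (zeroF j))) ⟩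
  zeroF j +F evalLin as (zeroF j)                  ≡⟨ +-identityˡ _ ⟩
  evalLin as (zeroF j)                             ≡⟨ evalLin-zero as ⟩
  zeroF j                                          ∎
  where open FRing j

module Ψ-step {j : ℕ} {U : Sub j} {U′ : Sub (suc j)} {φ : Mat j} {f : LinPoly j} {ξ : F (suc j)}
  (det≢0 : detM φ ≢ zeroF j) (φU≡graph : ImageIsGraph φ U f) (ξ∉F : ∀ a → ξ ≢ ι a)
  (U′≡F×S : IsPsiStep f ξ U U′) where

  open FRing (suc j) using (+-identityˡ; zeroʳ; *-identityʳ)

  S : F j → F (suc j)
  S u = fromBasis ξ (u , evalLin f u)

  ψ : V2 j → F (suc j)
  ψ w = fromBasis ξ (applyM φ w)

  ψ-injective : ∀ {v w} → ψ v ≡ ψ w → v ≡ w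
  ψ-injective = applyM-injective φ det≢0 ∘ fromBasis-injective ξ∉F

  ψ-surjective : ∀ y → ∃[ w ] ψ w ≡ y
  ψ-surjective y = w , trans (cong (fromBasis ξ) (proj₂ (applyM-surjective φ det≢0 v))) (proj₂ (fromBasis-surjective ξ∉F y))
    where
    v = proj₁ (fromBasis-surjective ξ∉F y)
    w = proj₁ (applyM-surjective φ det≢0 v)

  ψ-scale : ∀ a w → ψ (scale a w) ≡ ι a *F ψ w
  ψ-scale a w = trans (cong (fromBasis ξ) (applyM-scale φ a w)) (fromBasis-scale ξ a (applyM φ w))

  0∈U′ : U′ (zeroF (suc j) , zeroF (suc j)) ≡ true
  0∈U′ = proj₂ (U′≡F×S _) (zeroF j , zeroF j , cong (zeroF (suc j) ,_) (sym S0≡0))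
    where
    S0≡0 : S (zeroF j) ≡ zeroF (suc j)
    S0≡0 = begin
      ι (zeroF j) +F ξ *F ι (evalLin f (zeroF j))   ≡⟨ cong (λ y → ι (zeroF j) +F ξ *F ι y) (evalLin-zero f) ⟩
      zeroF (suc j) +F ξ *F zeroF (suc j)           ≡⟨ cong (zeroF (suc j) +F_) (zeroʳ ξ) ⟩
      zeroF (suc j) +F zeroF (suc j)                ≡⟨ +-identityˡ _ ⟩
      zeroF (suc j)                                 ∎

  wcard-∞ : wcard U′ nothing ≡ ∣F∣ j
  wcard-∞ = begin
    wcard U′ nothing                  ≡⟨ count-bijection (λ _ → true) (λ l → U′ (scale l (rep nothing))) S
                                           (elems-listing j) (elems-listing (suc j)) injective forth back ⟩
    count (λ _ → true) (elems j)      ≡⟨ trans (count-const true (elems j)) (ℕₚ.*-identityˡ _) ⟩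
    length (elems j)                  ≡⟨ length-elems j ⟩
    ∣F∣ j                             ∎
    where
    injective : ∀ {u u′} → true ≡ true → true ≡ true → S u ≡ S u′ → u ≡ u′
    injective _ _ = cong proj₁ ∘ fromBasis-injective ξ∉F
    forth : ∀ {u} → true ≡ true → U′ (scale (S u) (rep nothing)) ≡ true
    forth {u} _ = proj₂ (U′≡F×S _) (zeroF j , u , cong₂ _,_ (zeroʳ (S u)) (*-identityʳ (S u)))
    back : ∀ {l} → U′ (scale l (rep nothing)) ≡ true → ∃[ u ] true ≡ true × S u ≡ l
    back {l} l∈U′ with a , u , eq ← proj₁ (U′≡F×S _) l∈U′ = u , refl , sym (trans (sym (*-identityʳ l)) (cong proj₂ eq))

  wcard-finite : ∀ w → wcard U′ (just (ψ w)) ≡ spanCard U w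
  wcard-finite w = count-bijection (λ a → U (scale a w)) (λ l → U′ (scale l (rep (just (ψ w))))) ι
    (elems-listing j) (elems-listing (suc j)) (λ _ _ → proj₁ ∘ pair-injective) forth back
    where
    forth : ∀ {a} → U (scale a w) ≡ true → U′ (scale (ι a) (rep (just (ψ w)))) ≡ true
    forth {a} aw∈U with x , φaw≡graph ← proj₁ (φU≡graph _) (scale a w , aw∈U , refl) =
      proj₂ (U′≡F×S _) (a , x , cong₂ _,_ (*-identityʳ (ι a)) (trans (sym (ψ-scale a w)) (cong (fromBasis ξ) φaw≡graph)))
    back : ∀ {l} → U′ (scale l (rep (just (ψ w)))) ≡ true → ∃[ a ] U (scale a w) ≡ true × ι a ≡ l
    back {l} l∈U′ with a , u , eq ← proj₁ (U′≡F×S _) l∈U′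
      with refl ← trans (sym (*-identityʳ l)) (cong proj₁ eq)
      with w′ , w′∈U , φw′≡graph ← proj₂ (φU≡graph _) (u , refl) =
      a , subst (λ v → U v ≡ true) w′≡aw w′∈U , refl
      where
      w′≡aw : w′ ≡ scale a w
      w′≡aw = ψ-injective (begin
        ψ w′             ≡⟨ cong (fromBasis ξ) φw′≡graph ⟩
        S u              ≡⟨ sym (cong proj₂ eq) ⟩
        ι a *F ψ w       ≡⟨ sym (ψ-scale a w) ⟩
        ψ (scale a w)    ∎)

  count-finitePoints : ∀ p → count (λ y → p (wcard U′ (just y))) (elems (suc j)) ≡ count (λ w → p (spanCard U w)) (allV2 j)
  count-finitePoints p = count-bijection (λ w → p (spanCard U w)) (λ y → p (wcard U′ (just y))) ψ
    (allV2-listing j) (elems-listing (suc j)) (λ _ _ → ψ-injective) (λ {w} → trans (cong p (wcard-finite w))) back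
    where
    back : ∀ {y} → p (wcard U′ (just y)) ≡ true → ∃[ w ] p (spanCard U w) ≡ true × ψ w ≡ y
    back {y} py = w , trans (cong p (sym (wcard-finite w))) (subst (λ y′ → p (wcard U′ (just y′)) ≡ true) (sym ψw≡y) py) , ψw≡y
      where
      w = proj₁ (ψ-surjective y)
      ψw≡y = proj₂ (ψ-surjective y)

  nPoints-Ψ : U (zeroF j , zeroF j) ≡ true → ∀ p → nPoints U′ p ≡ 2 * ⟦ p (∣F∣ j) ⟧ + nPoints U p * (∣F∣ j ∸ 1)
  nPoints-Ψ 0∈U p = begin
    nPoints U′ p
      ≡⟨ count-∷ (p ∘ wcard U′) nothing _ ⟩
    ⟦ p (wcard U′ nothing) ⟧ + count (p ∘ wcard U′) (map just (elems (suc j)))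
      ≡⟨ cong₂ (λ n m → ⟦ p n ⟧ + m) wcard-∞ (count-map (p ∘ wcard U′) just (elems (suc j))) ⟩
    ⟦ p (∣F∣ j) ⟧ + count (λ y → p (wcard U′ (just y))) (elems (suc j))
      ≡⟨ cong (⟦ p (∣F∣ j) ⟧ +_) (count-finitePoints p) ⟩
    ⟦ p (∣F∣ j) ⟧ + count (λ w → p (spanCard U w)) (allV2 j)
      ≡⟨ cong (⟦ p (∣F∣ j) ⟧ +_) (count-spanCard U 0∈U p) ⟩
    ⟦ p (∣F∣ j) ⟧ + (⟦ p (∣F∣ j) ⟧ + nPoints U p * (∣F∣ j ∸ 1))
      ≡⟨ solve 2 (λ a n → a :+ (a :+ n) := con 2 :* a :+ n) refl ⟦ p (∣F∣ j) ⟧ (nPoints U p * (∣F∣ j ∸ 1)) ⟩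
    2 * ⟦ p (∣F∣ j) ⟧ + nPoints U p * (∣F∣ j ∸ 1) ∎
    where open +-*-Solver using (solve; con; _:+_; _:*_; _:=_)

nPoints-subline : ∀ (U : Sub 1) → IsSubline U → ∀ p → nPoints U p ≡ 3 * ⟦ p 2 ⟧ + 2 * ⟦ p 1 ⟧
nPoints-subline U ((0∈U , _) , |U|≡4 , wcard≤2) p = ℕₚ.+-cancelʳ-≡ _ _ _ (begin
  nPoints U p + ⟦ p 1 ⟧ * 3
    ≡⟨ cong₂ _+_ (count-cong (points 1) (λ {P} _ → cong p (wcard≡suc U 0∈U P))) (cong (⟦ p 1 ⟧ *_) (sym Σc≡3)) ⟩
  count (λ P → p (suc (c P))) (points 1) + ⟦ p 1 ⟧ * sum (map c (points 1))
    ≡⟨ count-twoValued p c (points 1) (λ {P} _ → c≤1 P) ⟩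
  ⟦ p 2 ⟧ * sum (map c (points 1)) + ⟦ p 1 ⟧ * 5
    ≡⟨ cong (λ n → ⟦ p 2 ⟧ * n + ⟦ p 1 ⟧ * 5) Σc≡3 ⟩
  ⟦ p 2 ⟧ * 3 + ⟦ p 1 ⟧ * 5
    ≡⟨ solve 2 (λ a b → b :* con 3 :+ a :* con 5 := con 3 :* b :+ con 2 :* a :+ a :* con 3) refl ⟦ p 1 ⟧ ⟦ p 2 ⟧ ⟩
  3 * ⟦ p 2 ⟧ + 2 * ⟦ p 1 ⟧ + ⟦ p 1 ⟧ * 3 ∎)
  where
  open +-*-Solver using (solve; con; _:+_; _:*_; _:=_)
  c : Point 1 → ℕ
  c P = count (λ l → not (isZeroᵇ l) ∧ U (scale l (rep P))) (elems 1)
  c≤1 : ∀ P → c P ≤ 1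
  c≤1 P = s≤s⁻¹ (subst (_≤ 2) (wcard≡suc U 0∈U P) (wcard≤2 P))
  Σc≡3 : sum (map c (points 1)) ≡ 3
  Σc≡3 = ℕₚ.suc-injective (begin
    suc (sum (map c (points 1)))                                  ≡⟨ cong suc (sym (count-nonzeroVectors U)) ⟩
    suc (count (λ v → not (isZeroVᵇ v) ∧ U v) (allV2 1))
      ≡⟨ cong (λ b → ⟦ b ⟧ + count (λ v → not (isZeroVᵇ v) ∧ U v) (allV2 1)) (sym 0∈U) ⟩
    ⟦ U (zeroF 1 , zeroF 1) ⟧ + count (λ v → not (isZeroVᵇ v) ∧ U v) (allV2 1)
      ≡⟨ sym (count-removeZeroV U) ⟩
    count U (allV2 1)                                             ≡⟨ |U|≡4 ⟩
    4                                                             ∎)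

-- Solving the recursion

-- The value of nPoints (U (suc n)) p, so that the subline U 1 is the case n = 0.
towerCount : ℕ → (ℕ → Bool) → ℕ
towerCount zero p = 3 * ⟦ p 2 ⟧ + 2 * ⟦ p 1 ⟧
towerCount (suc n) p = 2 * ⟦ p (∣F∣ (suc n)) ⟧ + towerCount n p * (∣F∣ (suc n) ∸ 1)

∣F∣-monotone : ∀ {m n} → m < n → ∣F∣ m < ∣F∣ n
∣F∣-monotone m<n = ℕₚ.^-monoʳ-< 2 (s≤s (s≤s z≤n)) (ℕₚ.^-monoʳ-< 2 (s≤s (s≤s z≤n)) m<n)

∣F∣≢ : ∀ k {n} → 1 ≤ k → n < 4 → ∣F∣ k ≢ n
∣F∣≢ (suc zero) _ n<4 refl = ℕₚ.<-irrefl refl n<4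
∣F∣≢ (suc (suc k)) _ n<4 refl = ℕₚ.<-asym n<4 (∣F∣-monotone {1} {suc (suc k)} (s≤s (s≤s z≤n)))

≡ᵇ-reflects : ∀ m n → Reflects (m ≡ n) (m ≡ᵇ n)
≡ᵇ-reflects m n = proof (m ℕ.≟ n)

≡ᵇ-refl : ∀ m → (m ≡ᵇ m) ≡ true
≡ᵇ-refl m = det (≡ᵇ-reflects m m) (ofʸ refl)

≢⇒≡ᵇfalse : ∀ {m n} → m ≢ n → (m ≡ᵇ n) ≡ false
≢⇒≡ᵇfalse {m} {n} m≢n = det (≡ᵇ-reflects m n) (ofⁿ m≢n)

drop-∷ʳ : ∀ {A : Set} k (xs : List A) x → k ≤ length xs → drop k (xs ∷ʳ x) ≡ drop k xs ∷ʳ x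
drop-∷ʳ zero xs x _ = refl
drop-∷ʳ (suc k) (y ∷ xs) x k<∣xs∣ = drop-∷ʳ k xs x (s≤s⁻¹ k<∣xs∣)

prodFrom-suc : ∀ k m → k ≤ m → prodFrom k (suc m) ≡ prodFrom k m * (∣F∣ m ∸ 1)
prodFrom-suc k m k≤m = begin
  product (map Q (drop k (upTo (suc m))))        ≡⟨ cong (product ∘ map Q ∘ drop k) (sym (upTo-∷ʳ m)) ⟩
  product (map Q (drop k (upTo m ∷ʳ m)))
    ≡⟨ cong (product ∘ map Q) (drop-∷ʳ k (upTo m) m (subst (k ≤_) (sym (length-upTo m)) k≤m)) ⟩
  product (map Q (drop k (upTo m) ∷ʳ m))         ≡⟨ cong product (map-++ Q (drop k (upTo m)) (m ∷ [])) ⟩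
  product (map Q (drop k (upTo m)) ++ Q m ∷ [])  ≡⟨ product-++ (map Q (drop k (upTo m))) (Q m ∷ []) ⟩
  prodFrom k m * (Q m * 1)                       ≡⟨ cong (prodFrom k m *_) (ℕₚ.*-identityʳ (Q m)) ⟩
  prodFrom k m * Q m                             ∎
  where
  Q : ℕ → ℕ
  Q i = ∣F∣ i ∸ 1

prodFrom-empty : ∀ k m → m ≤ k → prodFrom k m ≡ 1
prodFrom-empty k m m≤k =
  cong (product ∘ map (λ i → ∣F∣ i ∸ 1)) (drop-all k (upTo m) (subst (_≤ k) (sym (length-upTo m)) m≤k))

sum-map-*ʳ : ∀ {A : Set} (h : A → ℕ) c xs → sum (map (λ x → h x * c) xs) ≡ sum (map h xs) * c
sum-map-*ʳ h c [] = refl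
sum-map-*ʳ h c (x ∷ xs) = trans (cong (h x * c +_) (sum-map-*ʳ h c xs)) (sym (ℕₚ.*-distribʳ-+ c (h x) _))

sumProds-suc : ∀ m → sumProds (suc m) ≡ sumProds m * (∣F∣ m ∸ 1) + 1
sumProds-suc m = begin
  sum (map P′ (upTo (suc m)))                        ≡⟨ cong (sum ∘ map P′) (sym (upTo-∷ʳ m)) ⟩
  sum (map P′ (upTo m ∷ʳ m))                         ≡⟨ cong sum (map-++ P′ (upTo m) (m ∷ [])) ⟩
  sum (map P′ (upTo m) ++ P′ m ∷ [])                 ≡⟨ sum-++ (map P′ (upTo m)) (P′ m ∷ []) ⟩
  sum (map P′ (upTo m)) + (P′ m + 0)
    ≡⟨ cong₂ _+_ (cong sum (map-cong-local (All.tabulate shift))) (cong (_+ 0) (prodFrom-empty (suc m) (suc m) ℕₚ.≤-refl)) ⟩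
  sum (map (λ k → prodFrom (suc k) m * Q) (upTo m)) + 1
    ≡⟨ cong (_+ 1) (sum-map-*ʳ (λ k → prodFrom (suc k) m) Q (upTo m)) ⟩
  sumProds m * Q + 1                                 ∎
  where
  Q = ∣F∣ m ∸ 1
  P′ : ℕ → ℕ
  P′ k = prodFrom (suc k) (suc m)
  shift : ∀ {k} → k ∈ upTo m → P′ k ≡ prodFrom (suc k) m * Q
  shift k∈upTo = prodFrom-suc _ m (∈-upTo⁻ k∈upTo)

towerCount-suc-false : ∀ n p → p (∣F∣ (suc n)) ≡ false → towerCount (suc n) p ≡ towerCount n p * (∣F∣ (suc n) ∸ 1)
towerCount-suc-false n p p[q]≡false = cong (λ b → 2 * ⟦ b ⟧ + towerCount n p * (∣F∣ (suc n) ∸ 1)) p[q]≡false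

towerCount-weight1 : ∀ n → towerCount n (_≡ᵇ 2) ≡ 3 * prodFrom 1 (suc n)
towerCount-weight1 zero = refl
towerCount-weight1 (suc n) = begin
  towerCount (suc n) (_≡ᵇ 2)     ≡⟨ towerCount-suc-false n (_≡ᵇ 2) (≢⇒≡ᵇfalse (∣F∣≢ (suc n) (s≤s z≤n) (s≤s (s≤s (s≤s z≤n))))) ⟩
  towerCount n (_≡ᵇ 2) * Q       ≡⟨ cong (_* Q) (towerCount-weight1 n) ⟩
  3 * prodFrom 1 (suc n) * Q     ≡⟨ ℕₚ.*-assoc 3 (prodFrom 1 (suc n)) Q ⟩
  3 * (prodFrom 1 (suc n) * Q)   ≡⟨ cong (3 *_) (sym (prodFrom-suc 1 (suc n) (s≤s z≤n))) ⟩
  3 * prodFrom 1 (suc (suc n))   ∎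
  where Q = ∣F∣ (suc n) ∸ 1

towerCount-before : ∀ {k} n → 1 ≤ k → n < k → towerCount n (_≡ᵇ ∣F∣ k) ≡ 0
towerCount-before {k} zero 1≤k _ = cong₂ (λ a b → 3 * ⟦ a ⟧ + 2 * ⟦ b ⟧)
  (≢⇒≡ᵇfalse (∣F∣≢ k 1≤k (s≤s (s≤s (s≤s z≤n))) ∘ sym))
  (≢⇒≡ᵇfalse (∣F∣≢ k 1≤k (s≤s (s≤s z≤n)) ∘ sym))
towerCount-before {k} (suc n) 1≤k n<k = begin
  towerCount (suc n) (_≡ᵇ ∣F∣ k)                    ≡⟨ towerCount-suc-false n _ (≢⇒≡ᵇfalse (ℕₚ.<⇒≢ (∣F∣-monotone n<k))) ⟩
  towerCount n (_≡ᵇ ∣F∣ k) * (∣F∣ (suc n) ∸ 1)      ≡⟨ cong (_* (∣F∣ (suc n) ∸ 1)) (towerCount-before n 1≤k (ℕₚ.<⇒≤ n<k)) ⟩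
  0                                                ∎

towerCount-weight2^k : ∀ {k} n → 1 ≤ k → k ≤ n → towerCount n (_≡ᵇ ∣F∣ k) ≡ 2 * prodFrom (suc k) (suc n)
towerCount-weight2^k zero (s≤s _) ()
towerCount-weight2^k {k} (suc n) 1≤k k≤1+n with ℕₚ.m≤n⇒m<n∨m≡n k≤1+n
... | inj₂ refl = begin
  towerCount k (_≡ᵇ ∣F∣ k)
    ≡⟨ cong₂ (λ b m → 2 * ⟦ b ⟧ + m * (∣F∣ k ∸ 1)) (≡ᵇ-refl (∣F∣ k)) (towerCount-before n 1≤k ℕₚ.≤-refl) ⟩
  2                                   ≡⟨ cong (2 *_) (sym (prodFrom-empty (suc k) (suc k) ℕₚ.≤-refl)) ⟩
  2 * prodFrom (suc k) (suc k)        ∎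
... | inj₁ k<1+n = begin
  towerCount (suc n) (_≡ᵇ ∣F∣ k)      ≡⟨ towerCount-suc-false n _ (≢⇒≡ᵇfalse (ℕₚ.<⇒≢ (∣F∣-monotone k<1+n) ∘ sym)) ⟩
  towerCount n (_≡ᵇ ∣F∣ k) * Q        ≡⟨ cong (_* Q) (towerCount-weight2^k n 1≤k (s≤s⁻¹ k<1+n)) ⟩
  2 * prodFrom (suc k) (suc n) * Q    ≡⟨ ℕₚ.*-assoc 2 (prodFrom (suc k) (suc n)) Q ⟩
  2 * (prodFrom (suc k) (suc n) * Q)  ≡⟨ cong (2 *_) (sym (prodFrom-suc (suc k) (suc n) k<1+n)) ⟩
  2 * prodFrom (suc k) (suc (suc n))  ∎
  where Q = ∣F∣ (suc n) ∸ 1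

towerCount-size : ∀ n → towerCount n (λ w → not (w ≡ᵇ 1)) ≡ prodFrom 0 (suc n) + 2 * sumProds (suc n)
towerCount-size zero = refl
towerCount-size (suc n) = begin
  towerCount (suc n) (λ w → not (w ≡ᵇ 1))
    ≡⟨ cong₂ (λ b m → 2 * ⟦ not b ⟧ + m * Q) (≢⇒≡ᵇfalse (∣F∣≢ (suc n) (s≤s z≤n) (s≤s (s≤s z≤n)))) (towerCount-size n) ⟩
  2 + (prodFrom 0 (suc n) + 2 * sumProds (suc n)) * Q
    ≡⟨ solve 3 (λ q a s → con 2 :+ (a :+ con 2 :* s) :* q := a :* q :+ con 2 :* (s :* q :+ con 1))
             refl Q (prodFrom 0 (suc n)) (sumProds (suc n)) ⟩
  prodFrom 0 (suc n) * Q + 2 * (sumProds (suc n) * Q + 1)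
    ≡⟨ cong₂ (λ a s → a + 2 * s) (sym (prodFrom-suc 0 (suc n) z≤n)) (sym (sumProds-suc (suc n))) ⟩
  prodFrom 0 (suc (suc n)) + 2 * sumProds (suc (suc n)) ∎
  where
  open +-*-Solver using (solve; con; _:+_; _:*_; _:=_)
  Q = ∣F∣ (suc n) ∸ 1

corollary5p5 :
    (m : ℕ) → 1 ≤ m →
    (U : (j : ℕ) → Sub j) →
    (φ : (j : ℕ) → Mat j) →
    (f : (j : ℕ) → LinPoly j) →
    (ξ : (j : ℕ) → F (suc j)) →
    IsSubline (U 1) →
    (∀ j → 1 ≤ j → j < m →
      (¬ (detM (φ j) ≡ zeroF j)) ×
      ImageIsGraph (φ j) (U j) (f j) ×
      (¬ OneZeroInLf (f j)) ×
      (∀ (a : F j) → ¬ (ξ j ≡ ι a)) ×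
      IsPsiStep (f j) (ξ j) (U j) (U (suc j))) →
    (nWeight (U m) 1 ≡ 3 * prodFrom 1 m) ×
    (∀ k → 1 ≤ k → k < m → nWeight (U m) (2 ^ k) ≡ 2 * prodFrom (suc k) m) ×
    (sizeL (U m) ≡ prodFrom 0 m + 2 * sumProds m)
corollary5p5 (suc n) _ U φ f ξ subline steps =
  trans (nPoints≡towerCount (_≡ᵇ 2)) (towerCount-weight1 n) ,
  (λ k 1≤k k<m → trans (nPoints≡towerCount (_≡ᵇ ∣F∣ k)) (towerCount-weight2^k n 1≤k (s≤s⁻¹ k<m))) ,
  trans (sizeL≡nPoints (U (suc n)) (proj₁ (tower n ℕₚ.≤-refl))) (trans (nPoints≡towerCount _) (towerCount-size n))
  where
  tower : ∀ i → i ≤ n → U (suc i) (zeroF (suc i) , zeroF (suc i)) ≡ true × (∀ p → nPoints (U (suc i)) p ≡ towerCount i p)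
  tower zero _ = proj₁ (proj₁ subline) , nPoints-subline (U 1) subline
  tower (suc i) 1+i≤n =
    let (det≢0 , φU≡graph , _ , ξ∉F , U′≡F×S) = steps (suc i) (s≤s z≤n) (s≤s 1+i≤n)
        (0∈U , nPoints≡) = tower i (ℕₚ.<⇒≤ 1+i≤n)
        open Ψ-step {f = f (suc i)} det≢0 φU≡graph ξ∉F U′≡F×S
    in 0∈U′ , λ p → trans (nPoints-Ψ 0∈U p) (cong (λ c → 2 * ⟦ p (∣F∣ (suc i)) ⟧ + c * (∣F∣ (suc i) ∸ 1)) (nPoints≡ p))
  nPoints≡towerCount : ∀ p → nPoints (U (suc n)) p ≡ towerCount n p
  nPoints≡towerCount = proj₂ (tower n ℕₚ.≤-refl)
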